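{- Let $m$ be a positive integer and $p$ a prime with $p>m$. Let $q=\lfloor p/m\rfloor$. Define $f_{m,p,i}$ ($0\le i\le\varphi(m)-1$) and $f_{m,p,i,j}$ ($0\le j\le q$) by $$\Phi_{mp}=\sum_{i=0}^{\varphi(m)-1}f_{m,p,i}\,x^{ip},\ \deg f_{m,p,i}<p,\qquad f_{m,p,i}=\sum_{j=0}^{q}f_{m,p,i,j}\,x^{jm},\ \deg f_{m,p,i,j}<m.$$ Let $\psi(m)=\deg\Psi_m$ where $\Psi_m=(x^m-1)/\Phi_m$. Then for every $0\le i\le\varphi(m)-1$, $$\deg f_{m,p,i,0}-\operatorname{tdeg} f_{m,p,i,0}\ \ge\ \psi(m),$$ and equality holds when $i=0$.
   Context: $\Phi_n$ is the $n$-th cyclotomic polynomial, $\varphi$ is Euler's totient function, and $\Psi_m$ is the $m$-th inverse cyclotomic polynomial (so $\psi(m)=m-\varphi(m)$). For a nonzero polynomial $f$, $\operatorname{tdeg} f$ (trailing degree) is the smallest exponent whose coefficient in $f$ is nonzero. -}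

module Defs where

open import Data.Nat using (ℕ; zero; suc; _+_; _*_; _∸_; _≤_; _<_)
open import Data.Nat.Divisibility using (_∣?_)
open import Data.Nat.Coprimality using (coprime?)
open import Data.Integer using (ℤ; +_; -[1+_]) renaming (_+_ to _+ℤ_; _*_ to _*ℤ_)
open import Data.List using (List; []; _∷_; map; filter; upTo; foldr; length; replicate; _∷ʳ_)
open import Data.Product using (_×_)
open import Relation.Binary.PropositionalEquality using (_≡_; _≢_)

-- Polynomials over ℤ as coefficient lists, lowest degree first
-- (trailing zeros allowed; equality is coefficientwise).
Poly : Set
Poly = List ℤ

coeff : Poly → ℕ → ℤ
coeff []       _       = + 0
coeff (a ∷ _)  zero    = a
coeff (_ ∷ p)  (suc k) = coeff p k

_⊕_ : Poly → Poly → Poly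
[]      ⊕ q       = q
p       ⊕ []      = p
(a ∷ p) ⊕ (b ∷ q) = (a +ℤ b) ∷ (p ⊕ q)

_⊛_ : Poly → Poly → Poly
[]      ⊛ q = []
(a ∷ p) ⊛ q = map (a *ℤ_) q ⊕ (+ 0 ∷ (p ⊛ q))

prodP : List Poly → Poly
prodP = foldr _⊛_ (+ 1 ∷ [])

_≈P_ : Poly → Poly → Set
p ≈P q = ∀ k → coeff p k ≡ coeff q k

xPowSucMinus1 : ℕ → Poly
xPowSucMinus1 n = -[1+ 0 ] ∷ (replicate n (+ 0) ∷ʳ + 1)

divisors : ℕ → List ℕ
divisors n = filter (_∣? n) (map suc (upTo n))

-- Φ is the family of cyclotomic polynomials: x^n - 1 = ∏_{d ∣ n} Φ_d for all n ≥ 1.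
-- (This determines Φ_n for every n ≥ 1 uniquely, since ℤ[x] is a domain.)
IsCyclotomicFamily : (ℕ → Poly) → Set
IsCyclotomicFamily Φ = ∀ n → prodP (map Φ (divisors (suc n))) ≈P xPowSucMinus1 n

totient : ℕ → ℕ
totient m = length (filter (λ k → coprime? k m) (map suc (upTo m)))

-- ψ(m) = m - φ(m) = deg Ψ_m
ψ : ℕ → ℕ
ψ m = m ∸ totient m

IsDeg : Poly → ℕ → Set
IsDeg f d = coeff f d ≢ + 0 × (∀ k → d < k → coeff f k ≡ + 0)

IsTdeg : Poly → ℕ → Set
IsTdeg f t = coeff f t ≢ + 0 × (∀ k → k < t → coeff f k ≡ + 0)

-- f_{m,p,i}  = Σ_{k<p} [x^(ip+k)]Φ_{mp} · x^k
-- f_{m,p,i,0} = Σ_{k<m} [x^(ip+k)]Φ_{mp} · x^k   (the j = 0 block, degree < m)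
f-i : (ℕ → Poly) → ℕ → ℕ → ℕ → Poly
f-i Φ m p i = map (λ k → coeff (Φ (m * p)) (i * p + k)) (upTo p)

f-i0 : (ℕ → Poly) → ℕ → ℕ → ℕ → Poly
f-i0 Φ m p i = map (λ k → coeff (f-i Φ m p i) k) (upTo m)

-- Let Ψₘ = (xᵐ - 1)/Φₘ, of degree ψ(m); the degrees deg Φₙ = φ(n) come from
-- xⁿ - 1 = ∏_{d∣n} Φ_d and ∑_{d∣n} φ(d) = n. As p ∤ m, Φ_{mp} Φₘ = Φₘ(xᵖ), hence
-- (xᵐ - 1) Φ_{mp} = Ψₘ Φₘ(xᵖ). Reducing Φ_{mp} modulo x^(ip+m) to T and Φₘ modulo x^(i+1)
-- to B gives (xᵐ - 1) T = Ψₘ B(xᵖ) + x^(ip+m) f_{m,p,i,0}, because Ψₘ B(xᵖ) has degree at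
-- most ψ(m) + ip < ip + m. So Ψₘ divides x^(ip+m) f_{m,p,i,0}; being a divisor of xᵐ - 1 it
-- is prime to x, so it divides f_{m,p,i,0} / x^tdeg, which bounds deg - tdeg below by ψ(m).
-- The block is nonzero: otherwise Φₘ T = B(xᵖ), and since pᴷ ≡ 1 (mod m) this forces
-- Φₘ ∣ B, impossible as deg B ≤ i < φ(m). For i = 0 the identity reads
-- f_{m,p,0,0} = -Φₘ(0) Ψₘ, whose width is exactly ψ(m).

module Submission where

open import Defs
open import Data.Empty using (⊥-elim)
open import Data.Fin using (Fin; toℕ; fromℕ<)
import Data.Fin.Properties as Finₚ
open import Data.Integer as ℤ using (ℤ; +_; -[1+_]; -_) renaming (_+_ to _+ℤ_; _*_ to _*ℤ_)
import Data.Integer.Properties as ℤₚ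
open import Data.Integer.Tactic.RingSolver using (solve-∀)
open import Data.List using (List; []; _∷_; map; _++_; replicate; upTo; applyUpTo; drop; filter; length; [_]; _∷ʳ_)
import Data.List.Properties as Listₚ
open import Data.List.Membership.Propositional using (_∈_)
open import Data.List.Membership.Propositional.Properties using (∈-filter⁻; ∈-filter⁺; ∈-map⁻; ∈-map⁺; ∈-upTo⁻; ∈-upTo⁺; ∈-++⁺ˡ; ∈-++⁺ʳ; ∈-++⁻)
open import Data.List.Membership.Propositional.Properties.WithK using (unique∧set⇒bag)
import Data.List.Relation.Unary.All as All
open import Data.List.Relation.Unary.AllPairs using (_∷_)
open import Data.List.Relation.Unary.Any using (here; there)
open import Data.List.Relation.Unary.Unique.Propositional using (Unique)
import Data.List.Relation.Unary.Unique.Propositional.Properties as Uniqueₚ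
open import Data.List.Relation.Binary.BagAndSetEquality using (∼bag⇒↭)
open import Data.List.Relation.Binary.Permutation.Propositional as ↭ using (_↭_)
import Data.List.Relation.Binary.Permutation.Propositional.Properties as ↭ₚ
open import Data.Nat as ℕ using (ℕ; zero; suc; _∸_; z≤n; s≤s; _*_; _+_; _≤_; _<_; _≟_; _<?_; _^_)
open import Data.Nat.Coprimality as Coprimality using (Coprime; coprime?; coprime-divisor; coprime⇒gcd≡1; gcd≡1⇒coprime; prime⇒coprime)
open import Data.Nat.Divisibility using (_∣_; _∣?_; divides; ∣-refl; ∣-trans; ∣⇒≤; n∣m*n; m∣m*n; ∣m+n∣m⇒∣n; *-cancelʳ-∣; *-monoˡ-∣)
open import Data.Nat.DivMod using (_%_; _/_; m%n<n; m≡m%n+[m/n]*n)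
open import Data.Nat.GCD using (gcd; gcd[m,n]∣m; gcd[m,n]∣n; c*gcd[m,n]≡gcd[cm,cn])
open import Data.Nat.Induction using (<-rec)
open import Data.Nat.ListAction using (sum)
import Data.Nat.ListAction.Properties as Sumₚ
open import Data.Nat.Primality using (Prime; prime⇒irreducible; prime⇒nonZero)
import Data.Nat.Properties as ℕₚ
open import Algebra.Properties.CommutativeSemigroup ℕₚ.+-commutativeSemigroup using () renaming (interchange to +-interchange)
import Data.Nat.Tactic.RingSolver as ℕ-Solver
open import Data.Product using (Σ; _×_; _,_; proj₁; proj₂)
open import Data.Sum using (_⊎_; inj₁; inj₂)
open import Function using (_∘_; flip)
open import Function.Bundles using (mk⇔; _⇔_; Equivalence)
open import Relation.Binary.Bundles using (Setoid)
open import Relation.Binary.Definitions using (tri<; tri≈; tri>)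
open import Relation.Binary.PropositionalEquality hiding ([_])
import Relation.Binary.Reasoning.Setoid as SetoidReasoning
open import Relation.Nullary using (¬_; yes; no; Dec)

-- A record rather than Defs' _≈P_, so that both sides can be inferred from a proof.
infix 4 _≋_
record _≋_ (P Q : Poly) : Set where
  constructor mk≋
  field coeff-≡ : ∀ k → coeff P k ≡ coeff Q k
open _≋_ public

≋-refl : ∀ {P} → P ≋ P
≋-refl = mk≋ λ _ → refl

≋-reflexive : ∀ {P Q} → P ≡ Q → P ≋ Q
≋-reflexive refl = ≋-refl

≋-sym : ∀ {P Q} → P ≋ Q → Q ≋ P
≋-sym e = mk≋ λ k → sym (coeff-≡ e k)

≋-trans : ∀ {P Q R} → P ≋ Q → Q ≋ R → P ≋ R
≋-trans e f = mk≋ λ k → trans (coeff-≡ e k) (coeff-≡ f k)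

≋-setoid : Setoid _ _
≋-setoid = record
  { Carrier = Poly ; _≈_ = _≋_
  ; isEquivalence = record { refl = ≋-refl ; sym = ≋-sym ; trans = ≋-trans } }

module ≋-Reasoning = SetoidReasoning ≋-setoid

∷-cong : ∀ {a b P Q} → a ≡ b → P ≋ Q → (a ∷ P) ≋ (b ∷ Q)
∷-cong a≡b P≋Q = mk≋ λ { zero → a≡b ; (suc k) → coeff-≡ P≋Q k }

∷-injectiveʳ : ∀ {a b P Q} → (a ∷ P) ≋ (b ∷ Q) → P ≋ Q
∷-injectiveʳ e = mk≋ λ k → coeff-≡ e (suc k)

0∷-≋[] : ∀ {P} → P ≋ [] → (+ 0 ∷ P) ≋ []
0∷-≋[] e = mk≋ λ { zero → refl ; (suc k) → coeff-≡ e k }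

∷-≋[]ʳ : ∀ {a P} → (a ∷ P) ≋ [] → P ≋ []
∷-≋[]ʳ e = mk≋ λ k → coeff-≡ e (suc k)

coeff-tabulate-< : ∀ (f : ℕ → ℤ) {N n} → n < N → coeff (map f (upTo N)) n ≡ f n
coeff-tabulate-< f {N} {n} n<N = trans (cong (λ P → coeff P n) (Listₚ.map-upTo f N)) (coeff-applyUpTo f N n n<N)
  where
  coeff-applyUpTo : ∀ (f : ℕ → ℤ) N n → n < N → coeff (applyUpTo f N) n ≡ f n
  coeff-applyUpTo f (suc N) zero    _         = refl
  coeff-applyUpTo f (suc N) (suc n) (s≤s n<N) = coeff-applyUpTo (f ∘ suc) N n n<N

coeff-tabulate-≥ : ∀ (f : ℕ → ℤ) {N n} → N ≤ n → coeff (map f (upTo N)) n ≡ + 0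
coeff-tabulate-≥ f {N} {n} N≤n = trans (cong (λ P → coeff P n) (Listₚ.map-upTo f N)) (coeff-applyUpTo f N n N≤n)
  where
  coeff-applyUpTo : ∀ (f : ℕ → ℤ) N n → N ≤ n → coeff (applyUpTo f N) n ≡ + 0
  coeff-applyUpTo f zero    n       _         = refl
  coeff-applyUpTo f (suc N) (suc n) (s≤s N≤n) = coeff-applyUpTo (f ∘ suc) N n N≤n

split-at : ∀ N {A : ℕ → Set} → (∀ n → n < N → A n) → (∀ j → A (N + j)) → ∀ n → A n
split-at N {A} below above n with n <? N
... | yes n<N = below n n<N
... | no  n≮N = subst A (ℕₚ.m+[n∸m]≡n (ℕₚ.≮⇒≥ n≮N)) (above (n ∸ N))

-- Ring laws

scale : ℤ → Poly → Poly
scale a = map (a *ℤ_)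

neg : Poly → Poly
neg = map -_

shift : ℕ → Poly → Poly
shift k P = replicate k (+ 0) ++ P

coeff-⊕ : ∀ P Q k → coeff (P ⊕ Q) k ≡ coeff P k +ℤ coeff Q k
coeff-⊕ []      Q       k       = sym (ℤₚ.+-identityˡ _)
coeff-⊕ (a ∷ P) []      k       = sym (ℤₚ.+-identityʳ _)
coeff-⊕ (a ∷ P) (b ∷ Q) zero    = refl
coeff-⊕ (a ∷ P) (b ∷ Q) (suc k) = coeff-⊕ P Q k

coeff-scale : ∀ a P k → coeff (scale a P) k ≡ a *ℤ coeff P k
coeff-scale a []      k       = sym (ℤₚ.*-zeroʳ a)
coeff-scale a (b ∷ P) zero    = refl
coeff-scale a (b ∷ P) (suc k) = coeff-scale a P k

coeff-neg : ∀ P k → coeff (neg P) k ≡ - coeff P k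
coeff-neg []      k       = refl
coeff-neg (b ∷ P) zero    = refl
coeff-neg (b ∷ P) (suc k) = coeff-neg P k

coeff-shift-< : ∀ j P {k} → k < j → coeff (shift j P) k ≡ + 0
coeff-shift-< (suc j) P {zero}  _            = refl
coeff-shift-< (suc j) P {suc k} (s≤s k<j) = coeff-shift-< j P k<j

coeff-shift-+ : ∀ j P k → coeff (shift j P) (j + k) ≡ coeff P k
coeff-shift-+ zero    P k = refl
coeff-shift-+ (suc j) P k = coeff-shift-+ j P k

⊕-cong : ∀ {P P′ Q Q′} → P ≋ P′ → Q ≋ Q′ → (P ⊕ Q) ≋ (P′ ⊕ Q′)
⊕-cong {P} {P′} {Q} {Q′} e f = mk≋ λ k → begin
  coeff (P ⊕ Q) k             ≡⟨ coeff-⊕ P Q k ⟩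
  coeff P k +ℤ coeff Q k      ≡⟨ cong₂ _+ℤ_ (coeff-≡ e k) (coeff-≡ f k) ⟩
  coeff P′ k +ℤ coeff Q′ k    ≡⟨ coeff-⊕ P′ Q′ k ⟨
  coeff (P′ ⊕ Q′) k           ∎
  where open ≡-Reasoning

⊕-congˡ : ∀ {P P′} Q → P ≋ P′ → (P ⊕ Q) ≋ (P′ ⊕ Q)
⊕-congˡ Q e = ⊕-cong e ≋-refl

⊕-congʳ : ∀ P {Q Q′} → Q ≋ Q′ → (P ⊕ Q) ≋ (P ⊕ Q′)
⊕-congʳ P = ⊕-cong (≋-refl {P})

⊕-comm : ∀ P Q → (P ⊕ Q) ≋ (Q ⊕ P)
⊕-comm P Q = mk≋ λ k → begin
  coeff (P ⊕ Q) k          ≡⟨ coeff-⊕ P Q k ⟩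
  coeff P k +ℤ coeff Q k   ≡⟨ ℤₚ.+-comm (coeff P k) _ ⟩
  coeff Q k +ℤ coeff P k   ≡⟨ coeff-⊕ Q P k ⟨
  coeff (Q ⊕ P) k          ∎
  where open ≡-Reasoning

⊕-assoc : ∀ P Q R → ((P ⊕ Q) ⊕ R) ≋ (P ⊕ (Q ⊕ R))
⊕-assoc P Q R = mk≋ λ k → begin
  coeff ((P ⊕ Q) ⊕ R) k                      ≡⟨ coeff-⊕ (P ⊕ Q) R k ⟩
  coeff (P ⊕ Q) k +ℤ coeff R k               ≡⟨ cong (_+ℤ coeff R k) (coeff-⊕ P Q k) ⟩
  (coeff P k +ℤ coeff Q k) +ℤ coeff R k      ≡⟨ ℤₚ.+-assoc (coeff P k) _ _ ⟩
  coeff P k +ℤ (coeff Q k +ℤ coeff R k)      ≡⟨ cong (coeff P k +ℤ_) (coeff-⊕ Q R k) ⟨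
  coeff P k +ℤ coeff (Q ⊕ R) k               ≡⟨ coeff-⊕ P (Q ⊕ R) k ⟨
  coeff (P ⊕ (Q ⊕ R)) k                      ∎
  where open ≡-Reasoning

⊕-interchange : ∀ P Q R S → ((P ⊕ Q) ⊕ (R ⊕ S)) ≋ ((P ⊕ R) ⊕ (Q ⊕ S))
⊕-interchange P Q R S = mk≋ λ k → begin
  coeff ((P ⊕ Q) ⊕ (R ⊕ S)) k
    ≡⟨ trans (coeff-⊕ (P ⊕ Q) _ k) (cong₂ _+ℤ_ (coeff-⊕ P Q k) (coeff-⊕ R S k)) ⟩
  (coeff P k +ℤ coeff Q k) +ℤ (coeff R k +ℤ coeff S k)
    ≡⟨ lemma (coeff P k) (coeff Q k) (coeff R k) (coeff S k) ⟩
  (coeff P k +ℤ coeff R k) +ℤ (coeff Q k +ℤ coeff S k)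
    ≡⟨ trans (coeff-⊕ (P ⊕ R) _ k) (cong₂ _+ℤ_ (coeff-⊕ P R k) (coeff-⊕ Q S k)) ⟨
  coeff ((P ⊕ R) ⊕ (Q ⊕ S)) k ∎
  where
  open ≡-Reasoning
  lemma : ∀ w x y z → (w +ℤ x) +ℤ (y +ℤ z) ≡ (w +ℤ y) +ℤ (x +ℤ z)
  lemma = solve-∀

⊕-identityʳ : ∀ P → (P ⊕ []) ≋ P
⊕-identityʳ []      = ≋-refl
⊕-identityʳ (a ∷ P) = ≋-refl

⊕-inverseʳ : ∀ P → (P ⊕ neg P) ≋ []
⊕-inverseʳ P = mk≋ λ k → begin
  coeff (P ⊕ neg P) k         ≡⟨ coeff-⊕ P (neg P) k ⟩
  coeff P k +ℤ coeff (neg P) k ≡⟨ cong (coeff P k +ℤ_) (coeff-neg P k) ⟩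
  coeff P k +ℤ - coeff P k    ≡⟨ ℤₚ.+-inverseʳ (coeff P k) ⟩
  + 0                         ∎
  where open ≡-Reasoning

⊕-inverseˡ : ∀ P → (neg P ⊕ P) ≋ []
⊕-inverseˡ P = ≋-trans (⊕-comm (neg P) P) (⊕-inverseʳ P)

⊕-cancelˡ : ∀ R {P Q} → (R ⊕ P) ≋ (R ⊕ Q) → P ≋ Q
⊕-cancelˡ R {P} {Q} e = mk≋ λ k → cancel (coeff R k) (coeff P k) (coeff Q k)
  (trans (sym (coeff-⊕ R P k)) (trans (coeff-≡ e k) (coeff-⊕ R Q k)))
  where
  cancel : ∀ r x y → r +ℤ x ≡ r +ℤ y → x ≡ y
  cancel r x y r+x≡r+y = trans (sym (identity r x)) (trans (cong (- r +ℤ_) r+x≡r+y) (identity r y))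
    where
    identity : ∀ r z → - r +ℤ (r +ℤ z) ≡ z
    identity = solve-∀

⊕-neg-cancelˡ : ∀ P Q → (P ⊕ neg (P ⊕ neg Q)) ≋ Q
⊕-neg-cancelˡ P Q = mk≋ λ k → begin
  coeff (P ⊕ neg (P ⊕ neg Q)) k
    ≡⟨ coeff-⊕ P _ k ⟩
  coeff P k +ℤ coeff (neg (P ⊕ neg Q)) k
    ≡⟨ cong (coeff P k +ℤ_) (trans (coeff-neg (P ⊕ neg Q) k) (cong -_ (coeff-⊕ P (neg Q) k))) ⟩
  coeff P k +ℤ - (coeff P k +ℤ coeff (neg Q) k)
    ≡⟨ cong (λ z → coeff P k +ℤ - (coeff P k +ℤ z)) (coeff-neg Q k) ⟩
  coeff P k +ℤ - (coeff P k +ℤ - coeff Q k)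
    ≡⟨ lemma (coeff P k) (coeff Q k) ⟩
  coeff Q k ∎
  where
  open ≡-Reasoning
  lemma : ∀ x y → x +ℤ - (x +ℤ - y) ≡ y
  lemma = solve-∀

⊕-≋[]⇒≋ : ∀ {P Q} → (P ⊕ neg Q) ≋ [] → P ≋ Q
⊕-≋[]⇒≋ {P} {Q} z = mk≋ λ k → ℤₚ.i-j≡0⇒i≡j (coeff P k) (coeff Q k) (begin
  coeff P k +ℤ - coeff Q k      ≡⟨ cong (coeff P k +ℤ_) (coeff-neg Q k) ⟨
  coeff P k +ℤ coeff (neg Q) k  ≡⟨ coeff-⊕ P (neg Q) k ⟨
  coeff (P ⊕ neg Q) k           ≡⟨ coeff-≡ z k ⟩
  + 0                           ∎)
  where open ≡-Reasoning

scale-cong : ∀ a {P Q} → P ≋ Q → scale a P ≋ scale a Q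
scale-cong a {P} {Q} e = mk≋ λ k →
  trans (coeff-scale a P k) (trans (cong (a *ℤ_) (coeff-≡ e k)) (sym (coeff-scale a Q k)))

scale-0 : ∀ P → scale (+ 0) P ≋ []
scale-0 P = mk≋ λ k → trans (coeff-scale (+ 0) P k) (ℤₚ.*-zeroˡ (coeff P k))

scale-1 : ∀ P → scale (+ 1) P ≋ P
scale-1 P = mk≋ λ k → trans (coeff-scale (+ 1) P k) (ℤₚ.*-identityˡ _)

scale-+ : ∀ a b P → scale (a +ℤ b) P ≋ (scale a P ⊕ scale b P)
scale-+ a b P = mk≋ λ k → begin
  coeff (scale (a +ℤ b) P) k                  ≡⟨ coeff-scale (a +ℤ b) P k ⟩
  (a +ℤ b) *ℤ coeff P k                       ≡⟨ ℤₚ.*-distribʳ-+ (coeff P k) a b ⟩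
  a *ℤ coeff P k +ℤ b *ℤ coeff P k            ≡⟨ cong₂ _+ℤ_ (coeff-scale a P k) (coeff-scale b P k) ⟨
  coeff (scale a P) k +ℤ coeff (scale b P) k  ≡⟨ coeff-⊕ (scale a P) _ k ⟨
  coeff (scale a P ⊕ scale b P) k             ∎
  where open ≡-Reasoning

scale-⊕ : ∀ a P Q → scale a (P ⊕ Q) ≋ (scale a P ⊕ scale a Q)
scale-⊕ a P Q = mk≋ λ k → begin
  coeff (scale a (P ⊕ Q)) k                   ≡⟨ coeff-scale a (P ⊕ Q) k ⟩
  a *ℤ coeff (P ⊕ Q) k                        ≡⟨ cong (a *ℤ_) (coeff-⊕ P Q k) ⟩
  a *ℤ (coeff P k +ℤ coeff Q k)               ≡⟨ ℤₚ.*-distribˡ-+ a (coeff P k) _ ⟩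
  a *ℤ coeff P k +ℤ a *ℤ coeff Q k            ≡⟨ cong₂ _+ℤ_ (coeff-scale a P k) (coeff-scale a Q k) ⟨
  coeff (scale a P) k +ℤ coeff (scale a Q) k  ≡⟨ coeff-⊕ (scale a P) _ k ⟨
  coeff (scale a P ⊕ scale a Q) k             ∎
  where open ≡-Reasoning

scale-scale : ∀ a b P → scale a (scale b P) ≋ scale (a *ℤ b) P
scale-scale a b P = mk≋ λ k → begin
  coeff (scale a (scale b P)) k  ≡⟨ coeff-scale a (scale b P) k ⟩
  a *ℤ coeff (scale b P) k       ≡⟨ cong (a *ℤ_) (coeff-scale b P k) ⟩
  a *ℤ (b *ℤ coeff P k)          ≡⟨ ℤₚ.*-assoc a b (coeff P k) ⟨
  a *ℤ b *ℤ coeff P k            ≡⟨ coeff-scale (a *ℤ b) P k ⟨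
  coeff (scale (a *ℤ b) P) k     ∎
  where open ≡-Reasoning

neg≋scale-1 : ∀ P → neg P ≋ scale (- + 1) P
neg≋scale-1 P = mk≋ λ k →
  trans (coeff-neg P k) (trans (sym (ℤₚ.-1*i≡-i (coeff P k))) (sym (coeff-scale (- + 1) P k)))

neg-cong : ∀ {P Q} → P ≋ Q → neg P ≋ neg Q
neg-cong {P} {Q} e = mk≋ λ k → trans (coeff-neg P k) (trans (cong -_ (coeff-≡ e k)) (sym (coeff-neg Q k)))

⊛-zeroʳ : ∀ P → (P ⊛ []) ≋ []
⊛-zeroʳ []      = ≋-refl
⊛-zeroʳ (a ∷ P) = 0∷-≋[] (⊛-zeroʳ P)

⊛-zeroˡ : ∀ {P} Q → P ≋ [] → (P ⊛ Q) ≋ []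
⊛-zeroˡ {[]}    Q e = ≋-refl
⊛-zeroˡ {a ∷ P} Q e = ⊕-cong a·Q≋[] (0∷-≋[] (⊛-zeroˡ Q (∷-≋[]ʳ e)))
  where
  a·Q≋[] : scale a Q ≋ []
  a·Q≋[] = subst (λ z → scale z Q ≋ []) (sym (coeff-≡ e 0)) (scale-0 Q)

⊛-congˡ : ∀ {P P′} Q → P ≋ P′ → (P ⊛ Q) ≋ (P′ ⊛ Q)
⊛-congˡ {[]}    {P′}     Q e = ≋-sym (⊛-zeroˡ Q (≋-sym e))
⊛-congˡ {a ∷ P} {[]}     Q e = ⊛-zeroˡ Q e
⊛-congˡ {a ∷ P} {b ∷ P′} Q e =
  ⊕-cong (≋-reflexive (cong (λ z → scale z Q) (coeff-≡ e 0)))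
         (∷-cong refl (⊛-congˡ Q (∷-injectiveʳ e)))

⊛-congʳ : ∀ P {Q Q′} → Q ≋ Q′ → (P ⊛ Q) ≋ (P ⊛ Q′)
⊛-congʳ []      e = ≋-refl
⊛-congʳ (a ∷ P) e = ⊕-cong (scale-cong a e) (∷-cong refl (⊛-congʳ P e))

⊛-cong : ∀ {P P′ Q Q′} → P ≋ P′ → Q ≋ Q′ → (P ⊛ Q) ≋ (P′ ⊛ Q′)
⊛-cong {P′ = P′} {Q} e f = ≋-trans (⊛-congˡ Q e) (⊛-congʳ P′ f)

⊛-distribʳ-⊕ : ∀ Q P P′ → ((P ⊕ P′) ⊛ Q) ≋ ((P ⊛ Q) ⊕ (P′ ⊛ Q))
⊛-distribʳ-⊕ Q []      P′       = ≋-refl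
⊛-distribʳ-⊕ Q (a ∷ P) []       = ≋-sym (⊕-identityʳ _)
⊛-distribʳ-⊕ Q (a ∷ P) (b ∷ P′) =
  ≋-trans (⊕-cong (scale-+ a b Q) (∷-cong refl (⊛-distribʳ-⊕ Q P P′)))
          (⊕-interchange (scale a Q) (scale b Q) (+ 0 ∷ (P ⊛ Q)) (+ 0 ∷ (P′ ⊛ Q)))

scale-⊛ : ∀ a P Q → (scale a P ⊛ Q) ≋ scale a (P ⊛ Q)
scale-⊛ a []      Q = ≋-refl
scale-⊛ a (b ∷ P) Q =
  ≋-trans (⊕-cong (≋-sym (scale-scale a b Q)) (∷-cong (sym (ℤₚ.*-zeroʳ a)) (scale-⊛ a P Q)))
          (≋-sym (scale-⊕ a (scale b Q) (+ 0 ∷ (P ⊛ Q))))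

⊛-assoc : ∀ P Q R → ((P ⊛ Q) ⊛ R) ≋ (P ⊛ (Q ⊛ R))
⊛-assoc []      Q R = ≋-refl
⊛-assoc (a ∷ P) Q R = begin
  (scale a Q ⊕ (+ 0 ∷ (P ⊛ Q))) ⊛ R                  ≈⟨ ⊛-distribʳ-⊕ R (scale a Q) _ ⟩
  (scale a Q ⊛ R) ⊕ (scale (+ 0) R ⊕ (+ 0 ∷ ((P ⊛ Q) ⊛ R)))
    ≈⟨ ⊕-cong (scale-⊛ a Q R) (⊕-congˡ _ (scale-0 R)) ⟩
  scale a (Q ⊛ R) ⊕ (+ 0 ∷ ((P ⊛ Q) ⊛ R))            ≈⟨ ⊕-congʳ (scale a (Q ⊛ R)) (∷-cong refl (⊛-assoc P Q R)) ⟩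
  scale a (Q ⊛ R) ⊕ (+ 0 ∷ (P ⊛ (Q ⊛ R)))            ∎
  where open ≋-Reasoning

⊛-∷ʳ : ∀ P a Q → (P ⊛ (a ∷ Q)) ≋ (scale a P ⊕ (+ 0 ∷ (P ⊛ Q)))
⊛-∷ʳ []      a Q = ≋-sym (0∷-≋[] ≋-refl)
⊛-∷ʳ (b ∷ P) a Q = ≋-trans (⊕-congʳ (scale b (a ∷ Q)) (∷-cong refl (⊛-∷ʳ P a Q))) (mk≋ λ
  { zero    → cong (_+ℤ + 0) (ℤₚ.*-comm b a)
  ; (suc k) → begin
      coeff (scale b Q ⊕ (scale a P ⊕ R)) k
        ≡⟨ trans (coeff-⊕ (scale b Q) _ k) (cong (coeff (scale b Q) k +ℤ_) (coeff-⊕ (scale a P) R k)) ⟩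
      coeff (scale b Q) k +ℤ (coeff (scale a P) k +ℤ coeff R k)
        ≡⟨ lemma (coeff (scale b Q) k) (coeff (scale a P) k) (coeff R k) ⟩
      coeff (scale a P) k +ℤ (coeff (scale b Q) k +ℤ coeff R k)
        ≡⟨ trans (coeff-⊕ (scale a P) _ k) (cong (coeff (scale a P) k +ℤ_) (coeff-⊕ (scale b Q) R k)) ⟨
      coeff (scale a P ⊕ (scale b Q ⊕ R)) k ∎ })
  where
  open ≡-Reasoning
  R : Poly
  R = + 0 ∷ (P ⊛ Q)
  lemma : ∀ x y z → x +ℤ (y +ℤ z) ≡ y +ℤ (x +ℤ z)
  lemma = solve-∀

⊛-comm : ∀ P Q → (P ⊛ Q) ≋ (Q ⊛ P)
⊛-comm []      Q = ≋-sym (⊛-zeroʳ Q)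
⊛-comm (a ∷ P) Q = ≋-trans (⊕-congʳ (scale a Q) (∷-cong refl (⊛-comm P Q))) (≋-sym (⊛-∷ʳ Q a P))

⊛-distribˡ-⊕ : ∀ P Q Q′ → (P ⊛ (Q ⊕ Q′)) ≋ ((P ⊛ Q) ⊕ (P ⊛ Q′))
⊛-distribˡ-⊕ P Q Q′ = ≋-trans (⊛-comm P _) (≋-trans (⊛-distribʳ-⊕ P Q Q′) (⊕-cong (⊛-comm Q P) (⊛-comm Q′ P)))

⊛-identityˡ : ∀ P → ((+ 1 ∷ []) ⊛ P) ≋ P
⊛-identityˡ P = ≋-trans (⊕-cong (scale-1 P) (0∷-≋[] ≋-refl)) (⊕-identityʳ P)

⊛-identityʳ : ∀ P → (P ⊛ (+ 1 ∷ [])) ≋ P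
⊛-identityʳ P = ≋-trans (⊛-comm P _) (⊛-identityˡ P)

neg-⊛ : ∀ P Q → (neg P ⊛ Q) ≋ neg (P ⊛ Q)
neg-⊛ P Q = ≋-trans (⊛-congˡ Q (neg≋scale-1 P)) (≋-trans (scale-⊛ (- + 1) P Q) (≋-sym (neg≋scale-1 (P ⊛ Q))))

⊛-interchange : ∀ P Q R S → ((P ⊛ Q) ⊛ (R ⊛ S)) ≋ ((P ⊛ R) ⊛ (Q ⊛ S))
⊛-interchange P Q R S = begin
  (P ⊛ Q) ⊛ (R ⊛ S)  ≈⟨ ⊛-assoc P Q _ ⟩
  P ⊛ (Q ⊛ (R ⊛ S))  ≈⟨ ⊛-congʳ P (⊛-assoc Q R S) ⟨
  P ⊛ ((Q ⊛ R) ⊛ S)  ≈⟨ ⊛-congʳ P (⊛-congˡ S (⊛-comm Q R)) ⟩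
  P ⊛ ((R ⊛ Q) ⊛ S)  ≈⟨ ⊛-congʳ P (⊛-assoc R Q S) ⟩
  P ⊛ (R ⊛ (Q ⊛ S))  ≈⟨ ⊛-assoc P R _ ⟨
  (P ⊛ R) ⊛ (Q ⊛ S)  ∎
  where open ≋-Reasoning

prodP-++ : ∀ Ps Qs → prodP (Ps ++ Qs) ≋ (prodP Ps ⊛ prodP Qs)
prodP-++ []       Qs = ≋-sym (⊛-identityˡ _)
prodP-++ (P ∷ Ps) Qs = ≋-trans (⊛-congʳ P (prodP-++ Ps Qs)) (≋-sym (⊛-assoc P _ _))

prodP-↭ : ∀ {Ps Qs} → Ps ↭ Qs → prodP Ps ≋ prodP Qs
prodP-↭ ↭.refl           = ≋-refl
prodP-↭ (↭.prep P Ps↭Qs) = ⊛-congʳ P (prodP-↭ Ps↭Qs)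
prodP-↭ {P ∷ Q ∷ Ps} {_ ∷ _ ∷ Qs} (↭.swap _ _ Ps↭Qs) =
  ≋-trans (≋-sym (⊛-assoc P Q (prodP Ps))) (≋-trans (⊛-cong (⊛-comm P Q) (prodP-↭ Ps↭Qs)) (⊛-assoc Q P (prodP Qs)))
prodP-↭ (↭.trans Ps↭Qs Qs↭Rs) = ≋-trans (prodP-↭ Ps↭Qs) (prodP-↭ Qs↭Rs)

prodP-map-cong : ∀ {A : Set} {f g : A → Poly} xs → (∀ {x} → x ∈ xs → f x ≋ g x) → prodP (map f xs) ≋ prodP (map g xs)
prodP-map-cong []       f≋g = ≋-refl
prodP-map-cong (x ∷ xs) f≋g = ⊛-cong (f≋g (here refl)) (prodP-map-cong xs (f≋g ∘ there))

prodP-map-⊛ : ∀ {A : Set} (f g : A → Poly) xs → prodP (map (λ x → f x ⊛ g x) xs) ≋ (prodP (map f xs) ⊛ prodP (map g xs))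
prodP-map-⊛ f g []       = ≋-sym (⊛-identityˡ _)
prodP-map-⊛ f g (x ∷ xs) = ≋-trans (⊛-congʳ (f x ⊛ g x) (prodP-map-⊛ f g xs)) (⊛-interchange (f x) (g x) _ _)

-- Shifts, truncations and the substitution x ↦ xᵏ⁺¹

shift-cong : ∀ j {P Q} → P ≋ Q → shift j P ≋ shift j Q
shift-cong zero    e = e
shift-cong (suc j) e = ∷-cong refl (shift-cong j e)

shift-≋[] : ∀ j {P} → P ≋ [] → shift j P ≋ []
shift-≋[] zero    e = e
shift-≋[] (suc j) e = 0∷-≋[] (shift-≋[] j e)

shift-⊕ : ∀ j P Q → shift j (P ⊕ Q) ≋ (shift j P ⊕ shift j Q)
shift-⊕ zero    P Q = ≋-refl
shift-⊕ (suc j) P Q = ∷-cong refl (shift-⊕ j P Q)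

shift-shift : ∀ i j P → shift i (shift j P) ≋ shift (i + j) P
shift-shift zero    j P = ≋-refl
shift-shift (suc i) j P = ∷-cong refl (shift-shift i j P)

scale-shift : ∀ j a P → scale a (shift j P) ≋ shift j (scale a P)
scale-shift zero    a P = ≋-refl
scale-shift (suc j) a P = ∷-cong (ℤₚ.*-zeroʳ a) (scale-shift j a P)

neg-shift : ∀ j P → neg (shift j P) ≋ shift j (neg P)
neg-shift zero    P = ≋-refl
neg-shift (suc j) P = ∷-cong refl (neg-shift j P)

shift-⊛ : ∀ j P Q → (shift j P ⊛ Q) ≋ shift j (P ⊛ Q)
shift-⊛ zero    P Q = ≋-refl
shift-⊛ (suc j) P Q = ≋-trans (⊕-congˡ _ (scale-0 Q)) (∷-cong refl (shift-⊛ j P Q))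

⊛-shift : ∀ j P Q → (P ⊛ shift j Q) ≋ shift j (P ⊛ Q)
⊛-shift j P Q = ≋-trans (⊛-comm P _) (≋-trans (shift-⊛ j Q P) (shift-cong j (⊛-comm Q P)))

coeff-drop : ∀ j P n → coeff (drop j P) n ≡ coeff P (j + n)
coeff-drop zero    P       n = refl
coeff-drop (suc j) []      n = refl
coeff-drop (suc j) (a ∷ P) n = coeff-drop j P n

trunc : ℕ → Poly → Poly
trunc N P = map (coeff P) (upTo N)

trunc-⊕-shift-drop : ∀ N P → (trunc N P ⊕ shift N (drop N P)) ≋ P
trunc-⊕-shift-drop N P = mk≋ (split-at N below above)
  where
  below : ∀ n → n < N → coeff (trunc N P ⊕ shift N (drop N P)) n ≡ coeff P n
  below n n<N = trans (coeff-⊕ (trunc N P) _ n)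
    (trans (cong₂ _+ℤ_ (coeff-tabulate-< (coeff P) n<N) (coeff-shift-< N (drop N P) n<N)) (ℤₚ.+-identityʳ _))
  above : ∀ j → coeff (trunc N P ⊕ shift N (drop N P)) (N + j) ≡ coeff P (N + j)
  above j = trans (coeff-⊕ (trunc N P) _ (N + j))
    (trans (cong₂ _+ℤ_ (coeff-tabulate-≥ (coeff P) (ℕₚ.m≤m+n N j)) (trans (coeff-shift-+ N (drop N P) j) (coeff-drop N P j)))
           (ℤₚ.+-identityˡ _))

-- expand k P is P(x^(k+1)), with the exponent offset by one.
expand : ℕ → Poly → Poly
expand k []      = []
expand k (a ∷ P) = a ∷ shift k (expand k P)

coeff₀-expand : ∀ k P → coeff (expand k P) 0 ≡ coeff P 0
coeff₀-expand k []      = refl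
coeff₀-expand k (a ∷ P) = refl

expand-≋[] : ∀ k {P} → P ≋ [] → expand k P ≋ []
expand-≋[] k {[]}    e = ≋-refl
expand-≋[] k {a ∷ P} e = ≋-trans (∷-cong (coeff-≡ e 0) ≋-refl) (0∷-≋[] (shift-≋[] k (expand-≋[] k (∷-≋[]ʳ e))))

expand-cong : ∀ k {P Q} → P ≋ Q → expand k P ≋ expand k Q
expand-cong k {[]}    e = ≋-sym (expand-≋[] k (≋-sym e))
expand-cong k {a ∷ P} {[]}    e = expand-≋[] k e
expand-cong k {a ∷ P} {b ∷ Q} e = ∷-cong (coeff-≡ e 0) (shift-cong k (expand-cong k (∷-injectiveʳ e)))

expand-⊕ : ∀ k P Q → expand k (P ⊕ Q) ≋ (expand k P ⊕ expand k Q)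
expand-⊕ k []      Q       = ≋-refl
expand-⊕ k (a ∷ P) []      = ≋-sym (⊕-identityʳ _)
expand-⊕ k (a ∷ P) (b ∷ Q) = ∷-cong refl (≋-trans (shift-cong k (expand-⊕ k P Q)) (shift-⊕ k _ _))

expand-scale : ∀ k a P → expand k (scale a P) ≋ scale a (expand k P)
expand-scale k a []      = ≋-refl
expand-scale k a (b ∷ P) = ∷-cong refl (≋-trans (shift-cong k (expand-scale k a P)) (≋-sym (scale-shift k a _)))

expand-shift : ∀ k j P → expand k (shift j P) ≋ shift (j * suc k) (expand k P)
expand-shift k zero    P = ≋-refl
expand-shift k (suc j) P = ∷-cong refl (≋-trans (shift-cong k (expand-shift k j P)) (shift-shift k _ _))

expand-⊛ : ∀ k P Q → expand k (P ⊛ Q) ≋ (expand k P ⊛ expand k Q)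
expand-⊛ k []      Q = ≋-refl
expand-⊛ k (a ∷ P) Q = ≋-trans (expand-⊕ k (scale a Q) _)
  (⊕-cong (expand-scale k a Q) (∷-cong refl (≋-trans (shift-cong k (expand-⊛ k P Q)) (≋-sym (shift-⊛ k _ _)))))

expand-1 : ∀ k → expand k (+ 1 ∷ []) ≋ (+ 1 ∷ [])
expand-1 k = ∷-cong refl (shift-≋[] k ≋-refl)

expand-0 : ∀ P → expand 0 P ≋ P
expand-0 []      = ≋-refl
expand-0 (a ∷ P) = ∷-cong refl (expand-0 P)

expand-expand : ∀ a b c → suc c ≡ suc a * suc b → ∀ P → expand a (expand b P) ≋ expand c P
expand-expand a b c eq []      = ≋-refl
expand-expand a b c eq (x ∷ P) = ∷-cong refl (begin
  shift a (expand a (shift b (expand b P)))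
    ≈⟨ shift-cong a (expand-shift a b (expand b P)) ⟩
  shift a (shift (b * suc a) (expand a (expand b P)))
    ≈⟨ shift-cong a (shift-cong (b * suc a) (expand-expand a b c eq P)) ⟩
  shift a (shift (b * suc a) (expand c P))
    ≈⟨ shift-shift a _ _ ⟩
  shift (a + b * suc a) (expand c P)
    ≈⟨ ≋-reflexive (cong (λ n → shift n (expand c P)) exponent) ⟩
  shift c (expand c P) ∎)
  where
  open ≋-Reasoning
  exponent : a + b * suc a ≡ c
  exponent = ℕₚ.suc-injective (trans (identity a b) (sym eq))
    where
    identity : ∀ a b → suc (a + b * suc a) ≡ suc a * suc b
    identity = ℕ-Solver.solve-∀

expand-prodP : ∀ {A : Set} k (f : A → Poly) xs → expand k (prodP (map f xs)) ≋ prodP (map (expand k ∘ f) xs)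
expand-prodP k f []       = expand-1 k
expand-prodP k f (x ∷ xs) = ≋-trans (expand-⊛ k (f x) _) (⊛-congʳ (expand k (f x)) (expand-prodP k f xs))

-- Divisibility and congruences

infix 4 _∣P_
record _∣P_ (D P : Poly) : Set where
  constructor dividesP
  field
    quotient : Poly
    equation : (D ⊛ quotient) ≋ P

∣P-respʳ : ∀ {D P P′} → P ≋ P′ → D ∣P P → D ∣P P′
∣P-respʳ e (dividesP R eqn) = dividesP R (≋-trans eqn e)

∣P-refl : ∀ D → D ∣P D
∣P-refl D = dividesP (+ 1 ∷ []) (⊛-identityʳ D)

∣P-[] : ∀ D → D ∣P []
∣P-[] D = dividesP [] (⊛-zeroʳ D)

∣P-⊕ : ∀ {D P Q} → D ∣P P → D ∣P Q → D ∣P (P ⊕ Q)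
∣P-⊕ {D} (dividesP R e) (dividesP R′ e′) = dividesP (R ⊕ R′) (≋-trans (⊛-distribˡ-⊕ D R R′) (⊕-cong e e′))

∣P-neg : ∀ {D P} → D ∣P P → D ∣P neg P
∣P-neg {D} {P} (dividesP R e) = dividesP (neg R) (begin
  D ⊛ neg R   ≈⟨ ⊛-comm D (neg R) ⟩
  neg R ⊛ D   ≈⟨ neg-⊛ R D ⟩
  neg (R ⊛ D) ≈⟨ neg-cong (≋-trans (⊛-comm R D) e) ⟩
  neg P       ∎)
  where open ≋-Reasoning

∣P-⊕⇒∣P : ∀ {D P Q} → D ∣P P → D ∣P (P ⊕ Q) → D ∣P Q
∣P-⊕⇒∣P {P = P} {Q} D∣P D∣P⊕Q = ∣P-respʳ neg-⊕-cancelˡ (∣P-⊕ (∣P-neg D∣P) D∣P⊕Q)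
  where
  neg-⊕-cancelˡ : (neg P ⊕ (P ⊕ Q)) ≋ Q
  neg-⊕-cancelˡ = ≋-trans (≋-sym (⊕-assoc (neg P) P Q)) (≋-trans (⊕-congˡ Q (⊕-inverseˡ P)) ≋-refl)

∣P-⊛ˡ : ∀ {D P} Q → D ∣P P → D ∣P (Q ⊛ P)
∣P-⊛ˡ {D} {P} Q (dividesP R e) = dividesP (Q ⊛ R) (begin
  D ⊛ (Q ⊛ R) ≈⟨ ⊛-assoc D Q R ⟨
  (D ⊛ Q) ⊛ R ≈⟨ ⊛-congˡ R (⊛-comm D Q) ⟩
  (Q ⊛ D) ⊛ R ≈⟨ ⊛-assoc Q D R ⟩
  Q ⊛ (D ⊛ R) ≈⟨ ⊛-congʳ Q e ⟩
  Q ⊛ P       ∎)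
  where open ≋-Reasoning

∣P-⊛ʳ : ∀ {D P} Q → D ∣P P → D ∣P (P ⊛ Q)
∣P-⊛ʳ {P = P} Q d = ∣P-respʳ (⊛-comm Q P) (∣P-⊛ˡ Q d)

∣P-trans : ∀ {D E P} → D ∣P E → E ∣P P → D ∣P P
∣P-trans {D} (dividesP R e) (dividesP R′ e′) =
  dividesP (R ⊛ R′) (≋-trans (≋-sym (⊛-assoc D R R′)) (≋-trans (⊛-congˡ R′ e) e′))

∣P-shift : ∀ {D P} j → D ∣P P → D ∣P shift j P
∣P-shift {D} j (dividesP R e) = dividesP (shift j R) (≋-trans (⊛-shift j D R) (shift-cong j e))

∣P-expand : ∀ {D P} k → D ∣P P → expand k D ∣P expand k P
∣P-expand {D} k (dividesP R e) = dividesP (expand k R) (≋-trans (≋-sym (expand-⊛ k D R)) (expand-cong k e))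

infix 4 _≋_mod_
_≋_mod_ : Poly → Poly → Poly → Set
P ≋ Q mod D = D ∣P (P ⊕ neg Q)

∣P-mod : ∀ {D P Q} → P ≋ Q mod D → D ∣P P → D ∣P Q
∣P-mod {P = P} {Q} P≡Q D∣P = ∣P-respʳ (⊕-neg-cancelˡ P Q) (∣P-⊕ D∣P (∣P-neg P≡Q))

x^_⊖1 : ℕ → Poly
x^ e ⊖1 = (-[1+ 0 ] ∷ []) ⊕ shift e (+ 1 ∷ [])

x^⊖1-⊛ : ∀ e W → ((x^ e ⊖1) ⊛ W) ≋ (shift e W ⊕ neg W)
x^⊖1-⊛ e W = begin
  ((-[1+ 0 ] ∷ []) ⊕ shift e (+ 1 ∷ [])) ⊛ W        ≈⟨ ⊛-distribʳ-⊕ W (-[1+ 0 ] ∷ []) (shift e (+ 1 ∷ [])) ⟩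
  ((-[1+ 0 ] ∷ []) ⊛ W) ⊕ (shift e (+ 1 ∷ []) ⊛ W)  ≈⟨ ⊕-comm ((-[1+ 0 ] ∷ []) ⊛ W) _ ⟩
  (shift e (+ 1 ∷ []) ⊛ W) ⊕ ((-[1+ 0 ] ∷ []) ⊛ W)  ≈⟨ ⊕-cong x^e·W minus-W ⟩
  shift e W ⊕ neg W                                  ∎
  where
  open ≋-Reasoning
  x^e·W : (shift e (+ 1 ∷ []) ⊛ W) ≋ shift e W
  x^e·W = ≋-trans (shift-⊛ e (+ 1 ∷ []) W) (shift-cong e (⊛-identityˡ W))
  minus-W : ((-[1+ 0 ] ∷ []) ⊛ W) ≋ neg W
  minus-W = ≋-trans (⊕-congʳ (scale -[1+ 0 ] W) (0∷-≋[] ≋-refl))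
            (≋-trans (⊕-identityʳ _) (≋-sym (neg≋scale-1 W)))

expand-x^⊖1 : ∀ k e → expand k (x^ e ⊖1) ≋ x^ (e * suc k) ⊖1
expand-x^⊖1 k e = ≋-trans (expand-⊕ k (-[1+ 0 ] ∷ []) (shift e (+ 1 ∷ [])))
  (⊕-cong (∷-cong refl (shift-≋[] k ≋-refl)) (≋-trans (expand-shift k e (+ 1 ∷ [])) (shift-cong (e * suc k) (expand-1 k))))

shift-mod-x^⊖1 : ∀ m t W → shift (m * t) W ≋ W mod x^ m ⊖1
shift-mod-x^⊖1 m zero W = ∣P-respʳ (≋-sym W-W≋[]) (∣P-[] (x^ m ⊖1))
  where
  W-W≋[] : (shift (m * 0) W ⊕ neg W) ≋ []
  W-W≋[] = ≋-trans (≋-reflexive (cong (λ n → shift n W ⊕ neg W) (ℕₚ.*-zeroʳ m))) (⊕-inverseʳ W)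
shift-mod-x^⊖1 m (suc t) W = ∣P-respʳ telescope
  (∣P-⊕ (∣P-shift m (shift-mod-x^⊖1 m t W)) (dividesP W (x^⊖1-⊛ m W)))
  where
  telescope : (shift m (shift (m * t) W ⊕ neg W) ⊕ (shift m W ⊕ neg W)) ≋ (shift (m * suc t) W ⊕ neg W)
  telescope = begin
    shift m (shift (m * t) W ⊕ neg W) ⊕ (shift m W ⊕ neg W)
      ≈⟨ ⊕-congˡ _ (shift-⊕ m _ (neg W)) ⟩
    (shift m (shift (m * t) W) ⊕ shift m (neg W)) ⊕ (shift m W ⊕ neg W)
      ≈⟨ ⊕-assoc (shift m (shift (m * t) W)) _ _ ⟩
    shift m (shift (m * t) W) ⊕ (shift m (neg W) ⊕ (shift m W ⊕ neg W))
      ≈⟨ ⊕-cong (shift-shift m (m * t) W) (≋-sym (⊕-assoc (shift m (neg W)) _ _)) ⟩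
    shift (m + m * t) W ⊕ ((shift m (neg W) ⊕ shift m W) ⊕ neg W)
      ≈⟨ ⊕-cong (≋-reflexive (cong (λ n → shift n W) (sym (ℕₚ.*-suc m t))))
                (⊕-congˡ (neg W) (≋-trans (⊕-congˡ _ (≋-sym (neg-shift m W))) (⊕-inverseˡ (shift m W)))) ⟩
    shift (m * suc t) W ⊕ neg W ∎
    where open ≋-Reasoning

expand-mod-x^⊖1 : ∀ m t B → expand (m * t) B ≋ B mod x^ m ⊖1
expand-mod-x^⊖1 m t []      = ∣P-[] (x^ m ⊖1)
expand-mod-x^⊖1 m t (b ∷ B) = ∣P-respʳ (≋-sym split)
  (∣P-shift 1 (∣P-⊕ (∣P-shift c (expand-mod-x^⊖1 m t B)) (shift-mod-x^⊖1 m t B)))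
  where
  c : ℕ
  c = m * t
  regroup : (shift c (expand c B ⊕ neg B) ⊕ (shift c B ⊕ neg B)) ≋ (shift c (expand c B) ⊕ neg B)
  regroup = begin
    shift c (expand c B ⊕ neg B) ⊕ (shift c B ⊕ neg B)
      ≈⟨ ⊕-congˡ _ (shift-⊕ c (expand c B) (neg B)) ⟩
    (shift c (expand c B) ⊕ shift c (neg B)) ⊕ (shift c B ⊕ neg B)
      ≈⟨ ⊕-assoc (shift c (expand c B)) _ _ ⟩
    shift c (expand c B) ⊕ (shift c (neg B) ⊕ (shift c B ⊕ neg B))
      ≈⟨ ⊕-congʳ (shift c (expand c B)) (≋-sym (⊕-assoc (shift c (neg B)) _ _)) ⟩
    shift c (expand c B) ⊕ ((shift c (neg B) ⊕ shift c B) ⊕ neg B)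
      ≈⟨ ⊕-congʳ (shift c (expand c B))
           (⊕-congˡ (neg B) (≋-trans (⊕-congˡ _ (≋-sym (neg-shift c B))) (⊕-inverseˡ (shift c B)))) ⟩
    shift c (expand c B) ⊕ neg B ∎
    where open ≋-Reasoning
  split : (expand c (b ∷ B) ⊕ neg (b ∷ B)) ≋ shift 1 (shift c (expand c B ⊕ neg B) ⊕ (shift c B ⊕ neg B))
  split = ∷-cong (ℤₚ.+-inverseʳ b) (≋-sym regroup)

-- Modulo xᵐ - 1 the power xᴱ has the inverse x^(E(m-1)), since x^(mE) ≡ 1.
∣P-shift⁻¹ : ∀ {D k} E W → D ∣P x^ suc k ⊖1 → D ∣P shift E W → D ∣P W
∣P-shift⁻¹ {D} {k} E W D∣x^m⊖1 D∣xᴱW =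
  ∣P-mod {P = shift (suc k * E) W} (∣P-trans D∣x^m⊖1 (shift-mod-x^⊖1 (suc k) E W)) D∣x^mE·W
  where
  exponent : ∀ E k → E * k + E ≡ suc k * E
  exponent = ℕ-Solver.solve-∀
  D∣x^mE·W : D ∣P shift (suc k * E) W
  D∣x^mE·W = ∣P-respʳ (≋-trans (shift-shift (E * k) E W) (≋-reflexive (cong (λ n → shift n W) (exponent E k))))
                       (∣P-shift (E * k) D∣xᴱW)

-- Coefficients of products and degrees

sum< : ℕ → (ℕ → ℤ) → ℤ
sum< zero    f = + 0
sum< (suc n) f = sum< n f +ℤ f n

sum<-zero : ∀ n f → (∀ j → j < n → f j ≡ + 0) → sum< n f ≡ + 0
sum<-zero zero    f f≡0 = refl
sum<-zero (suc n) f f≡0 = cong₂ _+ℤ_ (sum<-zero n f (λ j j<n → f≡0 j (ℕₚ.m<n⇒m<1+n j<n))) (f≡0 n ℕₚ.≤-refl)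

sum<-cong : ∀ n {f g} → (∀ j → j < n → f j ≡ g j) → sum< n f ≡ sum< n g
sum<-cong zero    f≡g = refl
sum<-cong (suc n) f≡g = cong₂ _+ℤ_ (sum<-cong n (λ j j<n → f≡g j (ℕₚ.m<n⇒m<1+n j<n))) (f≡g n ℕₚ.≤-refl)

sum<-single : ∀ n f j₀ → j₀ < n → (∀ j → j < n → j ≢ j₀ → f j ≡ + 0) → sum< n f ≡ f j₀
sum<-single (suc n) f j₀ j₀<1+n f≡0 with ℕₚ.m≤n⇒m<n∨m≡n (ℕₚ.≤-pred j₀<1+n)
... | inj₂ refl = trans (cong (_+ℤ f j₀) (sum<-zero n f (λ j j<n → f≡0 j (ℕₚ.m<n⇒m<1+n j<n) (ℕₚ.<⇒≢ j<n))))
                        (ℤₚ.+-identityˡ _)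
... | inj₁ j₀<n = trans (cong₂ _+ℤ_ (sum<-single n f j₀ j₀<n (λ j j<n → f≡0 j (ℕₚ.m<n⇒m<1+n j<n)))
                                    (f≡0 n ℕₚ.≤-refl (λ n≡j₀ → ℕₚ.<⇒≢ j₀<n (sym n≡j₀))))
                        (ℤₚ.+-identityʳ _)

sum<-suc : ∀ n f → sum< (suc n) f ≡ f 0 +ℤ sum< n (λ j → f (suc j))
sum<-suc zero    f = trans (ℤₚ.+-identityˡ (f 0)) (sym (ℤₚ.+-identityʳ (f 0)))
sum<-suc (suc n) f = trans (cong (_+ℤ f (suc n)) (sum<-suc n f)) (ℤₚ.+-assoc (f 0) _ _)

coeff-⊛ : ∀ P Q n → coeff (P ⊛ Q) n ≡ sum< (suc n) (λ j → coeff P j *ℤ coeff Q (n ∸ j))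
coeff-⊛ []      Q n       = sym (sum<-zero (suc n) _ (λ _ _ → refl))
coeff-⊛ (a ∷ P) Q zero    = begin
  coeff (scale a Q ⊕ (+ 0 ∷ (P ⊛ Q))) 0 ≡⟨ coeff-⊕ (scale a Q) _ 0 ⟩
  coeff (scale a Q) 0 +ℤ + 0           ≡⟨ ℤₚ.+-identityʳ _ ⟩
  coeff (scale a Q) 0                  ≡⟨ coeff-scale a Q 0 ⟩
  a *ℤ coeff Q 0                       ≡⟨ ℤₚ.+-identityˡ _ ⟨
  + 0 +ℤ a *ℤ coeff Q 0                ∎
  where open ≡-Reasoning
coeff-⊛ (a ∷ P) Q (suc n) = begin
  coeff (scale a Q ⊕ (+ 0 ∷ (P ⊛ Q))) (suc n)
    ≡⟨ coeff-⊕ (scale a Q) _ (suc n) ⟩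
  coeff (scale a Q) (suc n) +ℤ coeff (P ⊛ Q) n
    ≡⟨ cong₂ _+ℤ_ (coeff-scale a Q (suc n)) (coeff-⊛ P Q n) ⟩
  a *ℤ coeff Q (suc n) +ℤ sum< (suc n) (λ j → coeff P j *ℤ coeff Q (n ∸ j))
    ≡⟨ sum<-suc (suc n) (λ j → coeff (a ∷ P) j *ℤ coeff Q (suc n ∸ j)) ⟨
  sum< (suc (suc n)) (λ j → coeff (a ∷ P) j *ℤ coeff Q (suc n ∸ j)) ∎
  where open ≡-Reasoning

coeff₀-⊛ : ∀ P Q → coeff (P ⊛ Q) 0 ≡ coeff P 0 *ℤ coeff Q 0
coeff₀-⊛ P Q = trans (coeff-⊛ P Q 0) (ℤₚ.+-identityˡ _)

coeff-⊛-trunc : ∀ Q P {N n} → n < N → coeff (Q ⊛ trunc N P) n ≡ coeff (Q ⊛ P) n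
coeff-⊛-trunc Q P {N} {n} n<N = begin
  coeff (Q ⊛ trunc N P) n                                 ≡⟨ coeff-⊛ Q (trunc N P) n ⟩
  sum< (suc n) (λ j → coeff Q j *ℤ coeff (trunc N P) (n ∸ j))
    ≡⟨ sum<-cong (suc n) (λ j _ → cong (coeff Q j *ℤ_) (coeff-tabulate-< (coeff P) (ℕₚ.≤-<-trans (ℕₚ.m∸n≤m n j) n<N))) ⟩
  sum< (suc n) (λ j → coeff Q j *ℤ coeff P (n ∸ j))       ≡⟨ coeff-⊛ Q P n ⟨
  coeff (Q ⊛ P) n                                         ∎
  where open ≡-Reasoning

Deg≤ : Poly → ℕ → Set
Deg≤ P e = ∀ k → e < k → coeff P k ≡ + 0

Monic : Poly → ℕ → Set
Monic P e = coeff P e ≡ + 1 × Deg≤ P e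

Deg≤-resp : ∀ {P P′} e → P ≋ P′ → Deg≤ P e → Deg≤ P′ e
Deg≤-resp e P≋P′ P≤e k e<k = trans (sym (coeff-≡ P≋P′ k)) (P≤e k e<k)

Deg≤-trunc : ∀ N P → Deg≤ (trunc (suc N) P) N
Deg≤-trunc N P k N<k = coeff-tabulate-≥ (coeff P) N<k

Deg≤-∷ : ∀ {a P d} → Deg≤ P d → Deg≤ (a ∷ P) (suc d)
Deg≤-∷ P≤d zero    ()
Deg≤-∷ P≤d (suc k) (s≤s d<k) = P≤d k d<k

Deg≤-shift : ∀ j {P d} → Deg≤ P d → Deg≤ (shift j P) (j + d)
Deg≤-shift zero    P≤d = P≤d
Deg≤-shift (suc j) P≤d = Deg≤-∷ (Deg≤-shift j P≤d)

Deg≤-expand : ∀ k P {d} → Deg≤ P d → Deg≤ (expand k P) (d * suc k)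
Deg≤-expand k []      P≤d = λ _ _ → refl
Deg≤-expand k (a ∷ P) {zero} P≤0 = Deg≤-resp 0 (≋-sym (∷-cong refl (shift-≋[] k (expand-≋[] k P≋[])))) λ
  { zero () ; (suc n) _ → refl }
  where
  P≋[] : P ≋ []
  P≋[] = mk≋ λ n → P≤0 (suc n) (s≤s z≤n)
Deg≤-expand k (a ∷ P) {suc d} P≤d = Deg≤-∷ (Deg≤-shift k (Deg≤-expand k P (λ n d<n → P≤d (suc n) (s≤s d<n))))

coeff-⊛-leading : ∀ P Q {d e} → Deg≤ P d → Deg≤ Q e → coeff (P ⊛ Q) (d + e) ≡ coeff P d *ℤ coeff Q e
coeff-⊛-leading P Q {d} {e} P≤d Q≤e = begin
  coeff (P ⊛ Q) (d + e)                                     ≡⟨ coeff-⊛ P Q (d + e) ⟩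
  sum< (suc (d + e)) (λ j → coeff P j *ℤ coeff Q (d + e ∸ j)) ≡⟨ sum<-single _ _ d (s≤s (ℕₚ.m≤m+n d e)) other ⟩
  coeff P d *ℤ coeff Q (d + e ∸ d)                           ≡⟨ cong (λ z → coeff P d *ℤ coeff Q z) (ℕₚ.m+n∸m≡n d e) ⟩
  coeff P d *ℤ coeff Q e                                       ∎
  where
  open ≡-Reasoning
  other : ∀ j → j < suc (d + e) → j ≢ d → coeff P j *ℤ coeff Q (d + e ∸ j) ≡ + 0
  other j _ j≢d with ℕₚ.<-cmp j d
  ... | tri≈ _ j≡d _ = ⊥-elim (j≢d j≡d)
  ... | tri> _ _ d<j = trans (cong (_*ℤ coeff Q (d + e ∸ j)) (P≤d j d<j)) (ℤₚ.*-zeroˡ (coeff Q (d + e ∸ j)))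
  ... | tri< j<d _ _ = trans (cong (coeff P j *ℤ_) (Q≤e _ e<d+e∸j)) (ℤₚ.*-zeroʳ (coeff P j))
    where
    e<d+e∸j : e < d + e ∸ j
    e<d+e∸j = subst (_< d + e ∸ j) (ℕₚ.m+n∸m≡n j e) (ℕₚ.∸-monoˡ-< (ℕₚ.+-monoˡ-< e j<d) (ℕₚ.m≤m+n j e))

⊛-Deg≤ : ∀ P Q {d e} → Deg≤ P d → Deg≤ Q e → Deg≤ (P ⊛ Q) (d + e)
⊛-Deg≤ P Q {d} {e} P≤d Q≤e k d+e<k = trans (coeff-⊛ P Q k) (sum<-zero (suc k) _ term≡0)
  where
  term≡0 : ∀ j → j < suc k → coeff P j *ℤ coeff Q (k ∸ j) ≡ + 0
  term≡0 j _ with d <? j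
  ... | yes d<j = trans (cong (_*ℤ coeff Q (k ∸ j)) (P≤d j d<j)) (ℤₚ.*-zeroˡ (coeff Q (k ∸ j)))
  ... | no  d≮j = trans (cong (coeff P j *ℤ_) (Q≤e _ e<k∸j)) (ℤₚ.*-zeroʳ (coeff P j))
    where
    e<k∸j : e < k ∸ j
    e<k∸j = ℕₚ.≤-<-trans (ℕₚ.≤-reflexive (sym (ℕₚ.m+n∸m≡n j e)))
              (ℕₚ.∸-monoˡ-< (ℕₚ.≤-<-trans (ℕₚ.+-monoˡ-≤ e (ℕₚ.≮⇒≥ d≮j)) d+e<k) (ℕₚ.m≤m+n j e))

⊛-Monic : ∀ P Q {d e} → Monic P d → Monic Q e → Monic (P ⊛ Q) (d + e)
⊛-Monic P Q (P₁ , P≤d) (Q₁ , Q≤e) = trans (coeff-⊛-leading P Q P≤d Q≤e) (cong₂ _*ℤ_ P₁ Q₁) , ⊛-Deg≤ P Q P≤d Q≤e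

prodP-Monic : ∀ {A : Set} (f : A → Poly) (deg : A → ℕ) xs → (∀ {x} → x ∈ xs → Monic (f x) (deg x)) →
  Monic (prodP (map f xs)) (sum (map deg xs))
prodP-Monic f deg []       _     = refl , λ { zero () ; (suc k) _ → refl }
prodP-Monic f deg (x ∷ xs) monic = ⊛-Monic (f x) _ (monic (here refl)) (prodP-Monic f deg xs (monic ∘ there))

x^⊖1-Monic : ∀ k → Monic (x^ suc k ⊖1) (suc k)
x^⊖1-Monic k = leading , above
  where
  coeff-x^⊖1 : ∀ j → coeff (x^ suc k ⊖1) (suc k + j) ≡ coeff (+ 1 ∷ []) j
  coeff-x^⊖1 j = trans (coeff-⊕ (-[1+ 0 ] ∷ []) (shift (suc k) (+ 1 ∷ [])) (suc k + j))
                       (trans (ℤₚ.+-identityˡ _) (coeff-shift-+ (suc k) (+ 1 ∷ []) j))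
  leading : coeff (x^ suc k ⊖1) (suc k) ≡ + 1
  leading = trans (cong (coeff (x^ suc k ⊖1)) (sym (ℕₚ.+-identityʳ (suc k)))) (coeff-x^⊖1 0)
  above : Deg≤ (x^ suc k ⊖1) (suc k)
  above n k<n = begin
    coeff (x^ suc k ⊖1) n                       ≡⟨ cong (coeff (x^ suc k ⊖1)) (ℕₚ.m+[n∸m]≡n (ℕₚ.<⇒≤ k<n)) ⟨
    coeff (x^ suc k ⊖1) (suc k + (n ∸ suc k)) ≡⟨ coeff-x^⊖1 (n ∸ suc k) ⟩
    coeff (+ 1 ∷ []) (n ∸ suc k)                ≡⟨ beyond-constant (ℕₚ.m>n⇒m∸n≢0 k<n) ⟩
    + 0                                         ∎
    where
    open ≡-Reasoning
    beyond-constant : ∀ {j} → j ≢ 0 → coeff (+ 1 ∷ []) j ≡ + 0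
    beyond-constant {zero}  j≢0 = ⊥-elim (j≢0 refl)
    beyond-constant {suc j} _   = refl

+1≢+0 : + 1 ≢ + 0
+1≢+0 ()

Monic⇒IsDeg : ∀ {P e} → Monic P e → IsDeg P e
Monic⇒IsDeg (P₁ , P≤e) = (λ Pe≡0 → +1≢+0 (trans (sym P₁) Pe≡0)) , P≤e

≋[]⊎IsDeg : ∀ P → P ≋ [] ⊎ Σ ℕ (IsDeg P)
≋[]⊎IsDeg [] = inj₁ ≋-refl
≋[]⊎IsDeg (a ∷ P) with ≋[]⊎IsDeg P
... | inj₂ (d , Pd≢0 , P≤d) = inj₂ (suc d , Pd≢0 , λ { zero () ; (suc k) (s≤s d<k) → P≤d k d<k })
... | inj₁ P≋[] with a ℤ.≟ + 0
...   | yes refl = inj₁ (0∷-≋[] P≋[])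
...   | no  a≢0  = inj₂ (0 , a≢0 , λ { zero () ; (suc k) _ → coeff-≡ P≋[] k })

≢[]⇒IsTdeg : ∀ P → ¬ (P ≋ []) → Σ ℕ (IsTdeg P)
≢[]⇒IsTdeg []      P≢[] = ⊥-elim (P≢[] ≋-refl)
≢[]⇒IsTdeg (a ∷ P) a∷P≢[] with a ℤ.≟ + 0
... | no a≢0  = 0 , a≢0 , λ _ ()
... | yes refl with ≢[]⇒IsTdeg P (λ P≋[] → a∷P≢[] (0∷-≋[] P≋[]))
...   | t , Pt≢0 , P<t≡0 = suc t , Pt≢0 , λ { zero _ → refl ; (suc k) (s≤s k<t) → P<t≡0 k k<t }

IsDeg-unique : ∀ {W d d′} → IsDeg W d → IsDeg W d′ → d ≡ d′
IsDeg-unique {d = d} {d′} (Wd≢0 , W≤d) (Wd′≢0 , W≤d′) with ℕₚ.<-cmp d d′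
... | tri≈ _ d≡d′ _ = d≡d′
... | tri< d<d′ _ _ = ⊥-elim (Wd′≢0 (W≤d d′ d<d′))
... | tri> _ _ d′<d = ⊥-elim (Wd≢0 (W≤d′ d d′<d))

IsTdeg-unique : ∀ {W t t′} → IsTdeg W t → IsTdeg W t′ → t ≡ t′
IsTdeg-unique {t = t} {t′} (Wt≢0 , W<t) (Wt′≢0 , W<t′) with ℕₚ.<-cmp t t′
... | tri≈ _ t≡t′ _ = t≡t′
... | tri< t<t′ _ _ = ⊥-elim (Wt≢0 (W<t′ t t<t′))
... | tri> _ _ t′<t = ⊥-elim (Wt′≢0 (W<t t′ t′<t))

IsDeg-resp : ∀ {P Q d} → P ≋ Q → IsDeg P d → IsDeg Q d
IsDeg-resp {P} {Q} {d} P≋Q (Pd≢0 , P≤d) = (λ Qd≡0 → Pd≢0 (trans (coeff-≡ P≋Q d) Qd≡0)) , Deg≤-resp d P≋Q P≤d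

coeff≢0⇒≤deg : ∀ {W d} n → IsDeg W d → coeff W n ≢ + 0 → n ≤ d
coeff≢0⇒≤deg {d = d} n (_ , W≤d) Wn≢0 with d <? n
... | yes d<n = ⊥-elim (Wn≢0 (W≤d n d<n))
... | no  d≮n = ℕₚ.≮⇒≥ d≮n

IsDeg-drop : ∀ {W t d} → t ≤ d → IsDeg W d → IsDeg (drop t W) (d ∸ t)
IsDeg-drop {W} {t} {d} t≤d (Wd≢0 , W≤d) = top≢0 , above
  where
  top≢0 : coeff (drop t W) (d ∸ t) ≢ + 0
  top≢0 = Wd≢0 ∘ trans (cong (coeff W) (sym (ℕₚ.m+[n∸m]≡n t≤d))) ∘ trans (sym (coeff-drop t W (d ∸ t)))
  above : Deg≤ (drop t W) (d ∸ t)
  above n d∸t<n = trans (coeff-drop t W n) (W≤d (t + n) d<t+n)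
    where
    d<t+n : d < t + n
    d<t+n = subst (_< t + n) (ℕₚ.m+[n∸m]≡n t≤d) (ℕₚ.+-monoʳ-< t d∸t<n)

scaled-Monic-IsDeg : ∀ {W P a e} → (∀ n → coeff W n ≡ a *ℤ coeff P n) → a ≢ + 0 → Monic P e → IsDeg W e
scaled-Monic-IsDeg {W} {P} {a} {e} W≡aP a≢0 (P₁ , P≤e) = We≢0 , W≤e
  where
  We≢0 : coeff W e ≢ + 0
  We≢0 We≡0 = a≢0 (trans (sym (ℤₚ.*-identityʳ a)) (trans (cong (a *ℤ_) (sym P₁)) (trans (sym (W≡aP e)) We≡0)))
  W≤e : ∀ n → e < n → coeff W n ≡ + 0
  W≤e n e<n = trans (W≡aP n) (trans (cong (a *ℤ_) (P≤e n e<n)) (ℤₚ.*-zeroʳ a))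

Monic-⊛-IsDeg : ∀ {R Q e r} → Monic R e → IsDeg Q r → IsDeg (R ⊛ Q) (e + r)
Monic-⊛-IsDeg {R} {Q} {e} {r} (R₁ , R≤e) (Qr≢0 , Q≤r) = leading≢0 , ⊛-Deg≤ R Q R≤e Q≤r
  where
  leading≢0 : coeff (R ⊛ Q) (e + r) ≢ + 0
  leading≢0 RQ[e+r]≡0 = Qr≢0 (begin
    coeff Q r                ≡⟨ ℤₚ.*-identityˡ (coeff Q r) ⟨
    + 1 *ℤ coeff Q r         ≡⟨ cong (_*ℤ coeff Q r) R₁ ⟨
    coeff R e *ℤ coeff Q r   ≡⟨ coeff-⊛-leading R Q R≤e Q≤r ⟨
    coeff (R ⊛ Q) (e + r)  ≡⟨ RQ[e+r]≡0 ⟩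
    + 0                      ∎)
    where open ≡-Reasoning

Monic-∣P-IsDeg⇒≤ : ∀ {R B e d} → Monic R e → R ∣P B → IsDeg B d → e ≤ d
Monic-∣P-IsDeg⇒≤ {R} {B} {e} {d} R-monic (dividesP Q RQ≋B) B-deg with ≋[]⊎IsDeg Q
... | inj₁ Q≋[] =
  ⊥-elim (proj₁ B-deg (trans (sym (coeff-≡ RQ≋B d)) (coeff-≡ (≋-trans (⊛-congʳ R Q≋[]) (⊛-zeroʳ R)) d)))
... | inj₂ (r , Q-deg) =
  subst (e ≤_) (IsDeg-unique {B} (IsDeg-resp RQ≋B (Monic-⊛-IsDeg {R} {Q} R-monic Q-deg)) B-deg) (ℕₚ.m≤m+n e r)

Monic-quotient : ∀ {R Q P e n} → Monic R e → (R ⊛ Q) ≋ P → Monic P n → Σ ℕ λ r → Monic Q r × e + r ≡ n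
Monic-quotient {R} {Q} {P} {e} {n} R-monic@(R₁ , R≤e) RQ≋P P-monic@(P₁ , _) with ≋[]⊎IsDeg Q
... | inj₁ Q≋[] =
  ⊥-elim (+1≢+0 (trans (sym P₁) (trans (sym (coeff-≡ RQ≋P n)) (coeff-≡ (≋-trans (⊛-congʳ R Q≋[]) (⊛-zeroʳ R)) n))))
... | inj₂ (r , Q-deg@(_ , Q≤r)) = r , (Q₁ , Q≤r) , e+r≡n
  where
  e+r≡n : e + r ≡ n
  e+r≡n = IsDeg-unique {P} (IsDeg-resp RQ≋P (Monic-⊛-IsDeg {R} {Q} R-monic Q-deg)) (Monic⇒IsDeg {P} P-monic)
  Q₁ : coeff Q r ≡ + 1
  Q₁ = begin
    coeff Q r                ≡⟨ ℤₚ.*-identityˡ (coeff Q r) ⟨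
    + 1 *ℤ coeff Q r         ≡⟨ cong (_*ℤ coeff Q r) R₁ ⟨
    coeff R e *ℤ coeff Q r   ≡⟨ coeff-⊛-leading R Q R≤e Q≤r ⟨
    coeff (R ⊛ Q) (e + r)    ≡⟨ coeff-≡ RQ≋P (e + r) ⟩
    coeff P (e + r)          ≡⟨ cong (coeff P) e+r≡n ⟩
    coeff P n                ≡⟨ P₁ ⟩
    + 1                      ∎
    where open ≡-Reasoning

⊛-≋[]⇒≋[] : ∀ {D Q} → coeff Q 0 ≢ + 0 → (D ⊛ Q) ≋ [] → D ≋ []
⊛-≋[]⇒≋[] {D} {Q} Q₀≢0 DQ≋[] = mk≋ (<-rec (λ n → coeff D n ≡ + 0) step)
  where
  step : ∀ n → (∀ {j} → j < n → coeff D j ≡ + 0) → coeff D n ≡ + 0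
  step n D<n≡0 with ℤₚ.i*j≡0⇒i≡0∨j≡0 (coeff D n) Dn·Q₀≡0
    where
    Dn·Q₀≡0 : coeff D n *ℤ coeff Q 0 ≡ + 0
    Dn·Q₀≡0 = begin
      coeff D n *ℤ coeff Q 0                                ≡⟨ cong (λ z → coeff D n *ℤ coeff Q z) (ℕₚ.n∸n≡0 n) ⟨
      coeff D n *ℤ coeff Q (n ∸ n)                          ≡⟨ sum<-single (suc n) _ n ℕₚ.≤-refl lower ⟨
      sum< (suc n) (λ j → coeff D j *ℤ coeff Q (n ∸ j))     ≡⟨ coeff-⊛ D Q n ⟨
      coeff (D ⊛ Q) n                                       ≡⟨ coeff-≡ DQ≋[] n ⟩
      + 0                                                   ∎
      where
      open ≡-Reasoning
      lower : ∀ j → j < suc n → j ≢ n → coeff D j *ℤ coeff Q (n ∸ j) ≡ + 0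
      lower j j≤n j≢n = trans (cong (_*ℤ coeff Q (n ∸ j)) (D<n≡0 (ℕₚ.≤∧≢⇒< (ℕₚ.≤-pred j≤n) j≢n)))
                              (ℤₚ.*-zeroˡ (coeff Q (n ∸ j)))
  ... | inj₁ Dn≡0  = Dn≡0
  ... | inj₂ Q₀≡0  = ⊥-elim (Q₀≢0 Q₀≡0)

⊛-cancelˡ : ∀ {Q A B} → coeff Q 0 ≢ + 0 → (Q ⊛ A) ≋ (Q ⊛ B) → A ≋ B
⊛-cancelˡ {Q} {A} {B} Q₀≢0 QA≋QB = ⊕-≋[]⇒≋ (⊛-≋[]⇒≋[] Q₀≢0 (begin
  (A ⊕ neg B) ⊛ Q            ≈⟨ ⊛-comm _ Q ⟩
  Q ⊛ (A ⊕ neg B)            ≈⟨ ⊛-distribˡ-⊕ Q A (neg B) ⟩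
  (Q ⊛ A) ⊕ (Q ⊛ neg B)      ≈⟨ ⊕-cong QA≋QB (≋-trans (⊛-comm Q (neg B)) (neg-⊛ B Q)) ⟩
  (Q ⊛ B) ⊕ neg (B ⊛ Q)      ≈⟨ ⊕-congʳ (Q ⊛ B) (neg-cong (⊛-comm B Q)) ⟩
  (Q ⊛ B) ⊕ neg (Q ⊛ B)      ≈⟨ ⊕-inverseʳ (Q ⊛ B) ⟩
  []                         ∎))
  where open ≋-Reasoning

-- Divisors and Euler's totient

∣⇒≤-pos : ∀ {d n} → 1 ≤ n → d ∣ n → d ≤ n
∣⇒≤-pos {n = suc n} _ = ∣⇒≤

∈-divisors⁻ : ∀ n {d} → d ∈ divisors n → 1 ≤ d × d ≤ n × d ∣ n
∈-divisors⁻ n d∈ with ∈-filter⁻ (_∣? n) {xs = map suc (upTo n)} d∈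
... | d∈range , d∣n with ∈-map⁻ suc d∈range
...   | x , x<n , refl = s≤s z≤n , ∈-upTo⁻ x<n , d∣n

∈-divisors⁺ : ∀ {n d} → 1 ≤ d → d ≤ n → d ∣ n → d ∈ divisors n
∈-divisors⁺ {n} {suc x} _ d≤n d∣n = ∈-filter⁺ (_∣? n) (∈-map⁺ suc (∈-upTo⁺ d≤n)) d∣n

divisors-unique : ∀ n → Unique (divisors n)
divisors-unique n = Uniqueₚ.filter⁺ (_∣? n) (Uniqueₚ.map⁺ ℕₚ.suc-injective (Uniqueₚ.upTo⁺ n))

divisors-*-prime : ∀ {n p} → Prime p → ¬ (p ∣ n) → 1 ≤ n → divisors (n * p) ↭ (divisors n ++ map (_* p) (divisors n))
divisors-*-prime {n} {p} p-prime p∤n 1≤n =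
  ∼bag⇒↭ (unique∧set⇒bag (divisors-unique (n * p)) unique (λ {x} → mk⇔ (to x) (from x)))
  where
  instance _ = prime⇒nonZero p-prime
  1≤p : 1 ≤ p
  1≤p = ℕ.>-nonZero⁻¹ p
  1≤np : 1 ≤ n * p
  1≤np = ℕₚ.*-mono-≤ 1≤n 1≤p
  disjoint : ∀ {v} → ¬ (v ∈ divisors n × v ∈ map (_* p) (divisors n))
  disjoint (v∈ , v∈p·) with ∈-map⁻ (_* p) v∈p·
  ... | d , _ , refl = p∤n (∣-trans (n∣m*n d) (proj₂ (proj₂ (∈-divisors⁻ n v∈))))
  unique : Unique (divisors n ++ map (_* p) (divisors n))
  unique = Uniqueₚ.++⁺ (divisors-unique n) (Uniqueₚ.map⁺ (λ {x} {y} → ℕₚ.*-cancelʳ-≡ x y p) (divisors-unique n)) disjoint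
  coprime-p : ∀ {x} → ¬ (p ∣ x) → Coprime x p
  coprime-p p∤x (c∣x , c∣p) with prime⇒irreducible p-prime c∣p
  ... | inj₁ c≡1 = c≡1
  ... | inj₂ refl = ⊥-elim (p∤x c∣x)
  to : ∀ x → x ∈ divisors (n * p) → x ∈ divisors n ++ map (_* p) (divisors n)
  to x x∈ with ∈-divisors⁻ (n * p) x∈
  ... | 1≤x , _ , x∣np with p ∣? x
  ...   | no p∤x = ∈-++⁺ˡ (∈-divisors⁺ 1≤x (∣⇒≤-pos 1≤n x∣n) x∣n)
    where
    x∣n : x ∣ n
    x∣n = coprime-divisor (coprime-p p∤x) (subst (x ∣_) (ℕₚ.*-comm n p) x∣np)
  ...   | yes (divides q refl) = ∈-++⁺ʳ (divisors n) (∈-map⁺ (_* p) (∈-divisors⁺ 1≤q (∣⇒≤-pos 1≤n q∣n) q∣n))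
    where
    q∣n : q ∣ n
    q∣n = *-cancelʳ-∣ p x∣np
    1≤q : 1 ≤ q
    1≤q = ℕₚ.n≢0⇒n>0 (λ { refl → ℕₚ.<⇒≱ 1≤x z≤n })
  from : ∀ x → x ∈ divisors n ++ map (_* p) (divisors n) → x ∈ divisors (n * p)
  from x x∈ with ∈-++⁻ (divisors n) x∈
  ... | inj₁ x∈divs with ∈-divisors⁻ n x∈divs
  ...   | 1≤x , _ , x∣n = ∈-divisors⁺ 1≤x (∣⇒≤-pos 1≤np x∣np) x∣np
    where
    x∣np : x ∣ n * p
    x∣np = ∣-trans x∣n (m∣m*n p)
  from x x∈ | inj₂ x∈p·divs with ∈-map⁻ (_* p) x∈p·divs
  ... | d , d∈ , refl with ∈-divisors⁻ n d∈
  ...   | 1≤d , _ , d∣n = ∈-divisors⁺ (ℕₚ.*-mono-≤ 1≤d 1≤p) (∣⇒≤-pos 1≤np dp∣np) dp∣np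
    where
    dp∣np : d * p ∣ n * p
    dp∣np = *-monoˡ-∣ p d∣n

properDivisors : ℕ → List ℕ
properDivisors n = filter (_∣? n) (map suc (upTo (n ∸ 1)))

divisors-∷ʳ : ∀ k → divisors (suc k) ≡ properDivisors (suc k) ∷ʳ suc k
divisors-∷ʳ k = begin
  filter (_∣? suc k) (map suc (upTo (suc k)))        ≡⟨ cong (filter (_∣? suc k) ∘ map suc) (Listₚ.upTo-∷ʳ k) ⟨
  filter (_∣? suc k) (map suc (upTo k ∷ʳ k))         ≡⟨ cong (filter (_∣? suc k)) (Listₚ.map-++ suc (upTo k) [ k ]) ⟩
  filter (_∣? suc k) (map suc (upTo k) ++ [ suc k ]) ≡⟨ Listₚ.filter-++ (_∣? suc k) (map suc (upTo k)) [ suc k ] ⟩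
  properDivisors (suc k) ++ filter (_∣? suc k) [ suc k ] ≡⟨ cong (properDivisors (suc k) ++_) (Listₚ.filter-accept (_∣? suc k) ∣-refl) ⟩
  properDivisors (suc k) ∷ʳ suc k                     ∎
  where open ≡-Reasoning

∈-properDivisors⁻ : ∀ {k d} → d ∈ properDivisors (suc k) → 1 ≤ d × d < suc k × d ∣ suc k
∈-properDivisors⁻ {k} d∈ with ∈-filter⁻ (_∣? suc k) {xs = map suc (upTo k)} d∈
... | d∈range , d∣n with ∈-map⁻ suc d∈range
...   | x , x<k , refl = s≤s z≤n , s≤s (∈-upTo⁻ x<k) , d∣n

indicator : ∀ {A : Set} → Dec A → ℕ
indicator (yes _) = 1
indicator (no  _) = 0

indicator-yes : ∀ {A : Set} (a? : Dec A) → A → indicator a? ≡ 1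
indicator-yes (yes _) _ = refl
indicator-yes (no ¬a) a = ⊥-elim (¬a a)

indicator-no : ∀ {A : Set} (a? : Dec A) → ¬ A → indicator a? ≡ 0
indicator-no (yes a) ¬a = ⊥-elim (¬a a)
indicator-no (no  _) _  = refl

indicator-⇔ : ∀ {A B : Set} (a? : Dec A) (b? : Dec B) → A ⇔ B → indicator a? ≡ indicator b?
indicator-⇔ a? (yes b) A⇔B = indicator-yes a? (Equivalence.from A⇔B b)
indicator-⇔ a? (no ¬b) A⇔B = indicator-no a? (¬b ∘ Equivalence.to A⇔B)

sum-indicator-none : ∀ {A : Set} {R : A → Set} (R? : ∀ a → Dec (R a)) xs →
  (∀ {y} → y ∈ xs → ¬ R y) → sum (map (indicator ∘ R?) xs) ≡ 0
sum-indicator-none R? []       _  = refl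
sum-indicator-none R? (x ∷ xs) ¬R = cong₂ _+_ (indicator-no (R? x) (¬R (here refl))) (sum-indicator-none R? xs (¬R ∘ there))

sum-indicator-unique : ∀ {A : Set} {R : A → Set} (R? : ∀ a → Dec (R a)) {x} xs → Unique xs → x ∈ xs → R x →
  (∀ {y} → y ∈ xs → R y → y ≡ x) → sum (map (indicator ∘ R?) xs) ≡ 1
sum-indicator-unique R? (y ∷ ys) (y∉ys ∷ _) (here refl) Rx only =
  cong₂ _+_ (indicator-yes (R? y) Rx) (sum-indicator-none R? ys (λ z∈ Rz → All.lookup y∉ys z∈ (sym (only (there z∈) Rz))))
sum-indicator-unique R? (y ∷ ys) (y∉ys ∷ uniq) (there x∈) Rx only =
  cong₂ _+_ (indicator-no (R? y) (λ Ry → All.lookup y∉ys x∈ (only (here refl) Ry)))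
            (sum-indicator-unique R? ys uniq x∈ Rx (only ∘ there))

-- sumTo f n = f 1 + ⋯ + f n
sumTo : (ℕ → ℕ) → ℕ → ℕ
sumTo f zero    = 0
sumTo f (suc n) = sumTo f n + f (suc n)

count : {P : ℕ → Set} → (∀ k → Dec (P k)) → ℕ → ℕ
count P? = sumTo (indicator ∘ P?)

sumTo-cong : ∀ n {f g} → (∀ k → 1 ≤ k → k ≤ n → f k ≡ g k) → sumTo f n ≡ sumTo g n
sumTo-cong zero    f≡g = refl
sumTo-cong (suc n) f≡g =
  cong₂ _+_ (sumTo-cong n (λ k 1≤k k≤n → f≡g k 1≤k (ℕₚ.m≤n⇒m≤1+n k≤n))) (f≡g (suc n) (s≤s z≤n) ℕₚ.≤-refl)

sumTo-1 : ∀ n → sumTo (λ _ → 1) n ≡ n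
sumTo-1 zero    = refl
sumTo-1 (suc n) = trans (cong (_+ 1) (sumTo-1 n)) (ℕₚ.+-comm n 1)

sumTo-0 : ∀ n → sumTo (λ _ → 0) n ≡ 0
sumTo-0 zero    = refl
sumTo-0 (suc n) = trans (ℕₚ.+-identityʳ _) (sumTo-0 n)

sumTo-+ : ∀ n f g → sumTo (λ k → f k + g k) n ≡ sumTo f n + sumTo g n
sumTo-+ zero    f g = refl
sumTo-+ (suc n) f g = trans (cong (_+ (f (suc n) + g (suc n))) (sumTo-+ n f g))
                            (+-interchange (sumTo f n) (sumTo g n) (f (suc n)) (g (suc n)))

sum-sumTo-comm : ∀ {A : Set} (f : A → ℕ → ℕ) xs n →
  sum (map (λ x → sumTo (f x) n) xs) ≡ sumTo (λ k → sum (map (λ x → f x k) xs)) n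
sum-sumTo-comm f []       n = sym (sumTo-0 n)
sum-sumTo-comm f (x ∷ xs) n = trans (cong (ℕ._+_ (sumTo (f x) n)) (sum-sumTo-comm f xs n))
                                    (sym (sumTo-+ n (f x) (λ k → sum (map (λ y → f y k) xs))))

length-filter-range : ∀ {P : ℕ → Set} (P? : ∀ k → Dec (P k)) n → length (filter P? (map suc (upTo n))) ≡ count P? n
length-filter-range P? zero    = refl
length-filter-range {P} P? (suc n) = begin
  length (filter P? (map suc (upTo (suc n))))
    ≡⟨ cong (length ∘ filter P? ∘ map suc) (Listₚ.upTo-∷ʳ n) ⟨
  length (filter P? (map suc (upTo n ∷ʳ n)))
    ≡⟨ cong (length ∘ filter P?) (Listₚ.map-++ suc (upTo n) [ n ]) ⟩
  length (filter P? (map suc (upTo n) ++ [ suc n ]))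
    ≡⟨ cong length (Listₚ.filter-++ P? (map suc (upTo n)) [ suc n ]) ⟩
  length (filter P? (map suc (upTo n)) ++ filter P? [ suc n ])
    ≡⟨ Listₚ.length-++ (filter P? (map suc (upTo n))) ⟩
  length (filter P? (map suc (upTo n))) + length (filter P? [ suc n ])
    ≡⟨ cong₂ _+_ (length-filter-range P? n) (last (P? (suc n))) ⟩
  count P? (suc n) ∎
  where
  open ≡-Reasoning
  last : (P?n : Dec (P (suc n))) → length (filter P? [ suc n ]) ≡ indicator (P? (suc n))
  last _ with P? (suc n)
  ... | yes _ = refl
  ... | no  _ = refl

module _ {P : ℕ → Set} (P? : ∀ k → Dec (P k)) {g′ : ℕ} (P⇒∣ : ∀ {k} → P k → suc g′ ∣ k) where

  private
    g : ℕ
    g = suc g′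

  count-within-block : ∀ c i → i < g → count P? (c * g + i) ≡ count P? (c * g)
  count-within-block c zero    _       = cong (count P?) (ℕₚ.+-identityʳ (c * g))
  count-within-block c (suc i) 1+i<g = begin
    count P? (c * g + suc i)                                  ≡⟨ cong (count P?) (ℕₚ.+-suc (c * g) i) ⟩
    count P? (c * g + i) + indicator (P? (suc (c * g + i)))   ≡⟨ cong (ℕ._+_ (count P? (c * g + i))) (indicator-no (P? _) ¬P) ⟩
    count P? (c * g + i) + 0                                  ≡⟨ ℕₚ.+-identityʳ _ ⟩
    count P? (c * g + i)                                      ≡⟨ count-within-block c i (ℕₚ.<-trans (ℕₚ.n<1+n i) 1+i<g) ⟩
    count P? (c * g)                                          ∎
    where
    open ≡-Reasoning
    ¬P : ¬ P (suc (c * g + i))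
    ¬P Pk = ℕₚ.<⇒≱ 1+i<g (∣⇒≤ (∣m+n∣m⇒∣n (subst (g ∣_) (sym (ℕₚ.+-suc (c * g) i)) (P⇒∣ Pk)) (n∣m*n c)))

  count-multiples : ∀ {Q : ℕ → Set} (Q? : ∀ c → Dec (Q c)) → (∀ c → P (suc c * g) ⇔ Q (suc c)) →
    ∀ c → count P? (c * g) ≡ count Q? c
  count-multiples Q? P⇔Q zero    = refl
  count-multiples {Q} Q? P⇔Q (suc c) = begin
    count P? (suc c * g)                                      ≡⟨ cong (count P?) (ℕₚ.+-comm g (c * g)) ⟩
    count P? (c * g + g)                                      ≡⟨ cong (count P?) (ℕₚ.+-suc (c * g) g′) ⟩
    count P? (c * g + g′) + indicator (P? (suc (c * g + g′))) ≡⟨ cong₂ _+_ (count-within-block c g′ ℕₚ.≤-refl) last ⟩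
    count P? (c * g) + indicator (Q? (suc c))                 ≡⟨ cong (_+ indicator (Q? (suc c))) (count-multiples Q? P⇔Q c) ⟩
    count Q? (suc c)                                          ∎
    where
    open ≡-Reasoning
    top : suc c * g ≡ suc (c * g + g′)
    top = trans (ℕₚ.+-comm g (c * g)) (ℕₚ.+-suc (c * g) g′)
    last : indicator (P? (suc (c * g + g′))) ≡ indicator (Q? (suc c))
    last = indicator-⇔ (P? _) (Q? (suc c)) (subst (λ k → P k ⇔ Q (suc c)) top (P⇔Q c))

-- The k ≤ gd with gcd(k, gd) = g are the k = cg with c coprime to d.
count-gcd≡totient : ∀ g′ d → 1 ≤ d → count (λ k → gcd k (suc g′ * d) * d ≟ suc g′ * d) (suc g′ * d) ≡ totient d
count-gcd≡totient g′ d 1≤d = begin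
  count P? N         ≡⟨ cong (count P?) (ℕₚ.*-comm g d) ⟩
  count P? (d * g)   ≡⟨ count-multiples P? P⇒∣ Q? P⇔Q d ⟩
  count Q? d         ≡⟨ length-filter-range Q? d ⟨
  totient d          ∎
  where
  open ≡-Reasoning
  instance _ = ℕ.>-nonZero 1≤d
  g N : ℕ
  g = suc g′
  N = g * d
  P? : ∀ k → Dec (gcd k N * d ≡ N)
  P? k = gcd k N * d ≟ N
  Q? : ∀ k → Dec (Coprime k d)
  Q? k = coprime? k d
  gcd≡g : ∀ {k} → gcd k N * d ≡ N → gcd k N ≡ g
  gcd≡g {k} = ℕₚ.*-cancelʳ-≡ (gcd k N) g d
  P⇒∣ : ∀ {k} → gcd k N * d ≡ N → g ∣ k
  P⇒∣ {k} P = subst (_∣ k) (gcd≡g {k} P) (gcd[m,n]∣m k N)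
  gcd-multiple : ∀ c → gcd (suc c * g) N ≡ g * gcd (suc c) d
  gcd-multiple c = trans (cong (λ z → gcd z N) (ℕₚ.*-comm (suc c) g)) (sym (c*gcd[m,n]≡gcd[cm,cn] g (suc c) d))
  P⇔Q : ∀ c → (gcd (suc c * g) N * d ≡ N) ⇔ Coprime (suc c) d
  P⇔Q c = mk⇔ to from
    where
    to : gcd (suc c * g) N * d ≡ N → Coprime (suc c) d
    to P = gcd≡1⇒coprime (ℕₚ.*-cancelˡ-≡ (gcd (suc c) d) 1 g
             (trans (sym (gcd-multiple c)) (trans (gcd≡g {suc c * g} P) (sym (ℕₚ.*-identityʳ g)))))
    from : Coprime (suc c) d → gcd (suc c * g) N * d ≡ N
    from c⊥d = cong (_* d) (trans (gcd-multiple c) (trans (cong (g *_) (coprime⇒gcd≡1 c⊥d)) (ℕₚ.*-identityʳ g)))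

-- Sort k ∈ [1, n] by the divisor d = n / gcd(k, n): each k has exactly one, and each d gets φ(d) of them.
sum-totient-divisors : ∀ n → 1 ≤ n → sum (map totient (divisors n)) ≡ n
sum-totient-divisors n 1≤n = begin
  sum (map totient (divisors n))                                     ≡⟨ sum-map-cong (divisors n) count≡totient ⟨
  sum (map (λ d → count (R? d) n) (divisors n))                      ≡⟨ sum-sumTo-comm (λ d → indicator ∘ R? d) (divisors n) n ⟩
  sumTo (λ k → sum (map (λ d → indicator (R? d k)) (divisors n))) n ≡⟨ sumTo-cong n (λ k 1≤k _ → exactly-one k 1≤k) ⟩
  sumTo (λ _ → 1) n                                                  ≡⟨ sumTo-1 n ⟩
  n                                                                  ∎
  where
  open ≡-Reasoning
  instance _ = ℕ.>-nonZero 1≤n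
  R? : ∀ d k → Dec (gcd k n * d ≡ n)
  R? d k = gcd k n * d ≟ n
  sum-map-cong : ∀ ds {f g : ℕ → ℕ} → (∀ {d} → d ∈ ds → f d ≡ g d) → sum (map f ds) ≡ sum (map g ds)
  sum-map-cong []       f≡g = refl
  sum-map-cong (d ∷ ds) f≡g = cong₂ _+_ (f≡g (here refl)) (sum-map-cong ds (f≡g ∘ there))
  count≡totient : ∀ {d} → d ∈ divisors n → count (R? d) n ≡ totient d
  count≡totient {d} d∈ with ∈-divisors⁻ n d∈
  ... | 1≤d , _ , divides zero     n≡0 = ⊥-elim (ℕₚ.<⇒≢ 1≤n (sym n≡0))
  ... | 1≤d , _ , divides (suc g′) refl = count-gcd≡totient g′ d 1≤d
  exactly-one : ∀ k → 1 ≤ k → sum (map (λ d → indicator (R? d k)) (divisors n)) ≡ 1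
  exactly-one k 1≤k with gcd[m,n]∣n k n
  ... | divides q n≡q·G = sum-indicator-unique (λ d → R? d k) (divisors n) (divisors-unique n) q∈ Rq only
    where
    G : ℕ
    G = gcd k n
    n≡G·q : n ≡ G * q
    n≡G·q = trans n≡q·G (ℕₚ.*-comm q G)
    q∈ : q ∈ divisors n
    q∈ = ∈-divisors⁺ (ℕₚ.n≢0⇒n>0 (λ { refl → ℕₚ.<⇒≢ 1≤n (sym n≡q·G) }))
                     (∣⇒≤ (divides G n≡G·q)) (divides G n≡G·q)
    Rq : G * q ≡ n
    Rq = sym n≡G·q
    only : ∀ {d} → d ∈ divisors n → G * d ≡ n → d ≡ q
    only {d} _ G·d≡n = ℕₚ.*-cancelˡ-≡ d q G {{G≢0}} (trans G·d≡n n≡G·q)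
      where
      G≢0 : ℕ.NonZero G
      G≢0 = ℕ.≢-nonZero λ G≡0 → ℕₚ.<⇒≢ 1≤n (sym (trans n≡G·q (cong (_* q) G≡0)))

sum-totient-properDivisors : ∀ k → sum (map totient (properDivisors (suc k))) + totient (suc k) ≡ suc k
sum-totient-properDivisors k = begin
  sum (map totient ds) + totient n        ≡⟨ cong (ℕ._+_ (sum (map totient ds))) (ℕₚ.+-identityʳ _) ⟨
  sum (map totient ds) + sum [ totient n ] ≡⟨ Sumₚ.sum-++ (map totient ds) _ ⟨
  sum (map totient ds ++ [ totient n ])   ≡⟨ cong sum (Listₚ.map-++ totient ds [ n ]) ⟨
  sum (map totient (ds ++ [ n ]))         ≡⟨ cong (sum ∘ map totient) (divisors-∷ʳ k) ⟨
  sum (map totient (divisors n))          ≡⟨ sum-totient-divisors n (s≤s z≤n) ⟩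
  n                                       ∎
  where
  open ≡-Reasoning
  n : ℕ
  n = suc k
  ds : List ℕ
  ds = properDivisors n

coprime-∣-pow* : ∀ {m p} → Coprime m p → ∀ a x → m ∣ p ^ a * x → m ∣ x
coprime-∣-pow* m⊥p zero    x m∣ = subst (_ ∣_) (ℕₚ.+-identityʳ x) m∣
coprime-∣-pow* {m} {p} m⊥p (suc a) x m∣ =
  coprime-∣-pow* m⊥p a x (coprime-divisor m⊥p (subst (m ∣_) (ℕₚ.*-assoc p (p ^ a) x) m∣))

-- Pigeonhole on the residues of p⁰, …, pᵐ gives pᵃ ≡ pᵇ (mod m) with a < b; cancel pᵃ.
pow≡1-mod : ∀ m p → 1 ≤ m → 1 ≤ p → Coprime m p → Σ ℕ λ K → Σ ℕ λ t → p ^ suc K ≡ suc (m * t)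
pow≡1-mod m p 1≤m 1≤p m⊥p with Finₚ.pigeonhole (ℕₚ.n<1+n m) residue
  where
  instance _ = ℕ.>-nonZero 1≤m
  residue : Fin (suc m) → Fin m
  residue j = fromℕ< (m%n<n (p ^ toℕ j) m)
... | i , j , i<j , same-residue = positive-power (b ∸ a) (ℕₚ.m>n⇒m∸n≢0 i<j) m∣p^[b-a]-1
  where
  instance _ = ℕ.>-nonZero 1≤m
  a b : ℕ
  a = toℕ i
  b = toℕ j
  p^a%m≡p^b%m : p ^ a % m ≡ p ^ b % m
  p^a%m≡p^b%m = trans (sym (Finₚ.toℕ-fromℕ< (m%n<n (p ^ a) m)))
                      (trans (cong toℕ same-residue) (Finₚ.toℕ-fromℕ< (m%n<n (p ^ b) m)))
  difference : p ^ b ∸ p ^ a ≡ (p ^ b / m ∸ p ^ a / m) * m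
  difference = begin
    p ^ b ∸ p ^ a                                            ≡⟨ cong₂ _∸_ (m≡m%n+[m/n]*n (p ^ b) m) (m≡m%n+[m/n]*n (p ^ a) m) ⟩
    (p ^ b % m + p ^ b / m * m) ∸ (p ^ a % m + p ^ a / m * m) ≡⟨ cong (λ r → (r + p ^ b / m * m) ∸ (p ^ a % m + p ^ a / m * m)) p^a%m≡p^b%m ⟨
    (p ^ a % m + p ^ b / m * m) ∸ (p ^ a % m + p ^ a / m * m) ≡⟨ ℕₚ.[m+n]∸[m+o]≡n∸o (p ^ a % m) (p ^ b / m * m) (p ^ a / m * m) ⟩
    p ^ b / m * m ∸ p ^ a / m * m                             ≡⟨ ℕₚ.*-distribʳ-∸ m (p ^ b / m) (p ^ a / m) ⟨
    (p ^ b / m ∸ p ^ a / m) * m                               ∎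
    where open ≡-Reasoning
  factor : p ^ b ∸ p ^ a ≡ p ^ a * (p ^ (b ∸ a) ∸ 1)
  factor = begin
    p ^ b ∸ p ^ a                    ≡⟨ cong (λ e → p ^ e ∸ p ^ a) (ℕₚ.m+[n∸m]≡n (ℕₚ.<⇒≤ i<j)) ⟨
    p ^ (a + (b ∸ a)) ∸ p ^ a        ≡⟨ cong₂ _∸_ (ℕₚ.^-distribˡ-+-* p a (b ∸ a)) (sym (ℕₚ.*-identityʳ (p ^ a))) ⟩
    p ^ a * p ^ (b ∸ a) ∸ p ^ a * 1  ≡⟨ ℕₚ.*-distribˡ-∸ (p ^ a) (p ^ (b ∸ a)) 1 ⟨
    p ^ a * (p ^ (b ∸ a) ∸ 1)        ∎
    where open ≡-Reasoning
  m∣p^[b-a]-1 : m ∣ p ^ (b ∸ a) ∸ 1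
  m∣p^[b-a]-1 = coprime-∣-pow* m⊥p a _ (subst (m ∣_) (trans (sym difference) factor) (n∣m*n (p ^ b / m ∸ p ^ a / m)))
  positive-power : ∀ k → k ≢ 0 → m ∣ p ^ k ∸ 1 → Σ ℕ λ K → Σ ℕ λ t → p ^ suc K ≡ suc (m * t)
  positive-power zero    k≢0 _ = ⊥-elim (k≢0 refl)
  positive-power (suc K) _   (divides t p^k∸1≡t·m) = K , t , (begin
    p ^ suc K            ≡⟨ ℕₚ.m∸n+n≡m {p ^ suc K} {1} (ℕₚ.m^n>0 p (suc K)) ⟨
    p ^ suc K ∸ 1 + 1    ≡⟨ cong (_+ 1) p^k∸1≡t·m ⟩
    t * m + 1            ≡⟨ ℕₚ.+-comm (t * m) 1 ⟩
    suc (t * m)          ≡⟨ cong suc (ℕₚ.*-comm t m) ⟩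
    suc (m * t)          ∎)
    where
    open ≡-Reasoning
    instance _ = ℕ.>-nonZero 1≤p

-- Cyclotomic polynomials

prodP-divisors-∷ʳ : ∀ (f : ℕ → Poly) k →
  prodP (map f (divisors (suc k))) ≋ (prodP (map f (properDivisors (suc k))) ⊛ f (suc k))
prodP-divisors-∷ʳ f k = begin
  prodP (map f (divisors (suc k)))                          ≈⟨ ≋-reflexive (cong (prodP ∘ map f) (divisors-∷ʳ k)) ⟩
  prodP (map f (properDivisors (suc k) ++ [ suc k ]))       ≈⟨ ≋-reflexive (cong prodP (Listₚ.map-++ f (properDivisors (suc k)) [ suc k ])) ⟩
  prodP (map f (properDivisors (suc k)) ++ [ f (suc k) ])   ≈⟨ prodP-++ (map f (properDivisors (suc k))) [ f (suc k) ] ⟩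
  prodP (map f (properDivisors (suc k))) ⊛ (f (suc k) ⊛ (+ 1 ∷ []))
    ≈⟨ ⊛-congʳ (prodP (map f (properDivisors (suc k)))) (⊛-identityʳ (f (suc k))) ⟩
  prodP (map f (properDivisors (suc k))) ⊛ f (suc k)        ∎
  where open ≋-Reasoning

module Cyclotomic (Φ : ℕ → Poly) (isCyclotomic : IsCyclotomicFamily Φ) where

  -- The inverse cyclotomic polynomial Ψₙ = (xⁿ - 1)/Φₙ.
  Ψ : ℕ → Poly
  Ψ n = prodP (map Φ (properDivisors n))

  Ψ⊛Φ : ∀ k → (Ψ (suc k) ⊛ Φ (suc k)) ≋ x^ suc k ⊖1
  Ψ⊛Φ k = ≋-trans (≋-sym (prodP-divisors-∷ʳ Φ k)) (mk≋ (isCyclotomic k))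

  coeff₀-Ψ⊛Φ : ∀ k → coeff (Ψ (suc k)) 0 *ℤ coeff (Φ (suc k)) 0 ≡ -[1+ 0 ]
  coeff₀-Ψ⊛Φ k = trans (sym (coeff₀-⊛ (Ψ (suc k)) (Φ (suc k)))) (coeff-≡ (Ψ⊛Φ k) 0)

  coeff₀-Ψ≢0 : ∀ k → coeff (Ψ (suc k)) 0 ≢ + 0
  coeff₀-Ψ≢0 k Ψ₀≡0 with () ← trans (sym (coeff₀-Ψ⊛Φ k))
    (trans (cong (_*ℤ coeff (Φ (suc k)) 0) Ψ₀≡0) (ℤₚ.*-zeroˡ (coeff (Φ (suc k)) 0)))

  coeff₀-Φ≢0 : ∀ k → coeff (Φ (suc k)) 0 ≢ + 0
  coeff₀-Φ≢0 k Φ₀≡0 with () ← trans (sym (coeff₀-Ψ⊛Φ k))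
    (trans (cong (coeff (Ψ (suc k)) 0 *ℤ_) Φ₀≡0) (ℤₚ.*-zeroʳ (coeff (Ψ (suc k)) 0)))

  Φ-Monic : ∀ n → 1 ≤ n → Monic (Φ n) (totient n)
  Φ-Monic = <-rec (λ n → 1 ≤ n → Monic (Φ n) (totient n)) step
    where
    step : ∀ n → (∀ {d} → d < n → 1 ≤ d → Monic (Φ d) (totient d)) → 1 ≤ n → Monic (Φ n) (totient n)
    step (suc k) ih _ with Monic-quotient {Ψ (suc k)} {Φ (suc k)} Ψ-Monic (Ψ⊛Φ k) (x^⊖1-Monic k)
      where
      Ψ-Monic : Monic (Ψ (suc k)) (sum (map totient (properDivisors (suc k))))
      Ψ-Monic = prodP-Monic Φ totient (properDivisors (suc k))
        (λ {d} d∈ → let 1≤d , d<n , _ = ∈-properDivisors⁻ d∈ in ih {d} d<n 1≤d)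
    ... | r , Φ-monic-r , e+r≡n = subst (Monic (Φ (suc k))) r≡φ Φ-monic-r
      where
      r≡φ : r ≡ totient (suc k)
      r≡φ = ℕₚ.+-cancelˡ-≡ (sum (map totient (properDivisors (suc k)))) r _
              (trans e+r≡n (sym (sum-totient-properDivisors k)))

  Ψ-Monic : ∀ k → Monic (Ψ (suc k)) (ψ (suc k))
  Ψ-Monic k = subst (Monic (Ψ (suc k))) e≡ψ Ψ-monic-e
    where
    e : ℕ
    e = sum (map totient (properDivisors (suc k)))
    Ψ-monic-e : Monic (Ψ (suc k)) e
    Ψ-monic-e = prodP-Monic Φ totient (properDivisors (suc k))
      (λ {d} d∈ → Φ-Monic d (proj₁ (∈-properDivisors⁻ {k} d∈)))
    e≡ψ : e ≡ ψ (suc k)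
    e≡ψ = trans (sym (ℕₚ.m+n∸n≡m e (totient (suc k)))) (cong (_∸ totient (suc k)) (sum-totient-properDivisors k))

  prodP-Φ-divisors : ∀ k → prodP (map Φ (divisors (suc k))) ≋ x^ suc k ⊖1
  prodP-Φ-divisors k = mk≋ (isCyclotomic k)

  module _ {p′ : ℕ} (p-prime : Prime (suc p′)) where

    private
      p : ℕ
      p = suc p′

    -- Both products equal x^(np) - 1 up to the factor Ψₙ(xᵖ): the divisors of np are those of n and their
    -- p-multiples, and by induction the proper divisors d of n contribute ∏ Φ_{dp} Φ_d = ∏ Φ_d(xᵖ) = Ψₙ(xᵖ).
    Φ[np]⊛Φ[n] : ∀ n → 1 ≤ n → ¬ (p ∣ n) → (Φ (n * p) ⊛ Φ n) ≋ expand p′ (Φ n)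
    Φ[np]⊛Φ[n] = <-rec (λ n → 1 ≤ n → ¬ (p ∣ n) → (Φ (n * p) ⊛ Φ n) ≋ expand p′ (Φ n)) step
      where
      g : ℕ → Poly
      g d = Φ (d * p) ⊛ Φ d
      step : ∀ n → (∀ {d} → d < n → 1 ≤ d → ¬ (p ∣ d) → g d ≋ expand p′ (Φ d)) →
             1 ≤ n → ¬ (p ∣ n) → g n ≋ expand p′ (Φ n)
      step (suc k) ih _ p∤n = ⊛-cancelˡ {Q = Q} Q₀≢0 (≋-trans (≋-sym via-divisors) via-x^np⊖1)
        where
        n : ℕ
        n = suc k
        Q : Poly
        Q = expand p′ (Ψ n)
        Q₀≢0 : coeff Q 0 ≢ + 0
        Q₀≢0 = coeff₀-Ψ≢0 k ∘ trans (sym (coeff₀-expand p′ (Ψ n)))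
        ih-proper : prodP (map g (properDivisors n)) ≋ Q
        ih-proper = ≋-trans
          (prodP-map-cong (properDivisors n) λ {d} d∈ →
            let 1≤d , d<n , d∣n = ∈-properDivisors⁻ {k} d∈ in ih {d} d<n 1≤d (p∤n ∘ flip ∣-trans d∣n))
          (≋-sym (expand-prodP p′ Φ (properDivisors n)))
        via-divisors : prodP (map Φ (divisors (n * p))) ≋ (Q ⊛ g n)
        via-divisors = begin
          prodP (map Φ (divisors (n * p)))
            ≈⟨ prodP-↭ (↭ₚ.map⁺ Φ (divisors-*-prime p-prime p∤n (s≤s z≤n))) ⟩
          prodP (map Φ (divisors n ++ map (_* p) (divisors n)))
            ≈⟨ ≋-reflexive (cong prodP (Listₚ.map-++ Φ (divisors n) (map (_* p) (divisors n)))) ⟩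
          prodP (map Φ (divisors n) ++ map Φ (map (_* p) (divisors n)))
            ≈⟨ prodP-++ (map Φ (divisors n)) (map Φ (map (_* p) (divisors n))) ⟩
          prodP (map Φ (divisors n)) ⊛ prodP (map Φ (map (_* p) (divisors n)))
            ≈⟨ ⊛-comm (prodP (map Φ (divisors n))) _ ⟩
          prodP (map Φ (map (_* p) (divisors n))) ⊛ prodP (map Φ (divisors n))
            ≈⟨ ⊛-congˡ (prodP (map Φ (divisors n))) (≋-reflexive (cong prodP (Listₚ.map-∘ (divisors n)))) ⟨
          prodP (map (λ d → Φ (d * p)) (divisors n)) ⊛ prodP (map Φ (divisors n))
            ≈⟨ prodP-map-⊛ (λ d → Φ (d * p)) Φ (divisors n) ⟨
          prodP (map g (divisors n))
            ≈⟨ prodP-divisors-∷ʳ g k ⟩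
          prodP (map g (properDivisors n)) ⊛ g n
            ≈⟨ ⊛-congˡ (g n) ih-proper ⟩
          Q ⊛ g n ∎
          where open ≋-Reasoning
        via-x^np⊖1 : prodP (map Φ (divisors (n * p))) ≋ (Q ⊛ expand p′ (Φ n))
        via-x^np⊖1 = begin
          prodP (map Φ (divisors (n * p)))  ≈⟨ prodP-Φ-divisors (p′ + k * p) ⟩
          x^ n * p ⊖1                       ≈⟨ expand-x^⊖1 p′ n ⟨
          expand p′ (x^ n ⊖1)               ≈⟨ expand-cong p′ (Ψ⊛Φ k) ⟨
          expand p′ (Ψ n ⊛ Φ n)             ≈⟨ expand-⊛ p′ (Ψ n) (Φ n) ⟩
          Q ⊛ expand p′ (Φ n)               ∎
          where open ≋-Reasoning

suc-pow∸1 : ∀ p′ K → suc (suc p′ ^ K ∸ 1) ≡ suc p′ ^ K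
suc-pow∸1 p′ K = trans (ℕₚ.+-comm 1 _) (ℕₚ.m∸n+n≡m (ℕₚ.m^n>0 (suc p′) K))

∣P-expand-pow : ∀ {G p′} → G ∣P expand p′ G → ∀ K → G ∣P expand (suc p′ ^ K ∸ 1) G
∣P-expand-pow {G}      G∣G[xᵖ] zero    = ∣P-respʳ (≋-sym (expand-0 G)) (∣P-refl G)
∣P-expand-pow {G} {p′} G∣G[xᵖ] (suc K) =
  ∣P-trans G∣G[xᵖ] (∣P-respʳ (expand-expand p′ c c′ exponent G) (∣P-expand p′ (∣P-expand-pow G∣G[xᵖ] K)))
  where
  c c′ : ℕ
  c  = suc p′ ^ K ∸ 1
  c′ = suc p′ ^ suc K ∸ 1
  exponent : suc c′ ≡ suc p′ * suc c
  exponent = trans (suc-pow∸1 p′ (suc K)) (cong (suc p′ *_) (sym (suc-pow∸1 p′ K)))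

-- B(x^(1+mt)) is an expansion of B(xᵖ), as 1 + mt = pᴷ⁺¹, and agrees with B modulo xᵐ - 1.
∣P-expand⇒∣P : ∀ {G B m p′ K t} → G ∣P x^ m ⊖1 → G ∣P expand p′ G → suc p′ ^ suc K ≡ suc (m * t) →
  G ∣P expand p′ B → G ∣P B
∣P-expand⇒∣P {G} {B} {m} {p′} {K} {t} G∣x^m⊖1 G∣G[xᵖ] pᴷ⁺¹≡1+mt G∣B[xᵖ] =
  ∣P-mod {P = expand (m * t) B} (∣P-trans G∣x^m⊖1 (expand-mod-x^⊖1 m t B)) G∣B[x^1+mt]
  where
  c : ℕ
  c = suc p′ ^ K ∸ 1
  exponent : suc (m * t) ≡ suc c * suc p′
  exponent = trans (sym pᴷ⁺¹≡1+mt) (trans (ℕₚ.*-comm (suc p′) (suc p′ ^ K)) (cong (_* suc p′) (sym (suc-pow∸1 p′ K))))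
  G∣B[x^1+mt] : G ∣P expand (m * t) B
  G∣B[x^1+mt] = ∣P-trans (∣P-expand-pow G∣G[xᵖ] K) (∣P-respʳ (expand-expand c p′ (m * t) exponent B) (∣P-expand c G∣B[xᵖ]))

shift-drop-IsTdeg : ∀ {W t} → IsTdeg W t → shift t (drop t W) ≋ W
shift-drop-IsTdeg {W} {t} (_ , W<t≡0) = mk≋ (split-at t
  (λ n n<t → trans (coeff-shift-< t (drop t W) n<t) (sym (W<t≡0 n n<t)))
  (λ j → trans (coeff-shift-+ t (drop t W) j) (coeff-drop t W j)))

Monic-∣P-shift⇒deg+tdeg≤deg : ∀ {D W e k E t d} → Monic D e → D ∣P x^ suc k ⊖1 → D ∣P shift E W →
  IsTdeg W t → IsDeg W d → e + t ≤ d
Monic-∣P-shift⇒deg+tdeg≤deg {D} {W} {e} {k} {E} {t} {d} D-monic D∣x^m⊖1 D∣xᴱW W-tdeg W-deg = begin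
  e + t          ≤⟨ ℕₚ.+-monoˡ-≤ t (Monic-∣P-IsDeg⇒≤ D-monic D∣W′ (IsDeg-drop t≤d W-deg)) ⟩
  d ∸ t + t      ≡⟨ ℕₚ.m∸n+n≡m t≤d ⟩
  d              ∎
  where
  open ℕₚ.≤-Reasoning
  t≤d : t ≤ d
  t≤d = coeff≢0⇒≤deg {W} t W-deg (proj₁ W-tdeg)
  W′ : Poly
  W′ = drop t W
  D∣W′ : D ∣P W′
  D∣W′ = ∣P-shift⁻¹ (E + t) W′ D∣x^m⊖1
           (∣P-respʳ (shift-shift E t W′) (∣P-respʳ (shift-cong E (≋-sym (shift-drop-IsTdeg W-tdeg))) D∣xᴱW))

-- The blocks f_{m,p,i,0}

coeff-x^⊖1-⊛ : ∀ m P n → coeff ((x^ m ⊖1) ⊛ P) (m + n) ≡ coeff P n +ℤ - coeff P (m + n)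
coeff-x^⊖1-⊛ m P n = begin
  coeff ((x^ m ⊖1) ⊛ P) (m + n)                     ≡⟨ coeff-≡ (x^⊖1-⊛ m P) (m + n) ⟩
  coeff (shift m P ⊕ neg P) (m + n)                 ≡⟨ coeff-⊕ (shift m P) (neg P) (m + n) ⟩
  coeff (shift m P) (m + n) +ℤ coeff (neg P) (m + n) ≡⟨ cong₂ _+ℤ_ (coeff-shift-+ m P n) (coeff-neg P (m + n)) ⟩
  coeff P n +ℤ - coeff P (m + n)                    ∎
  where open ≡-Reasoning

module Theorem5 (Φ : ℕ → Poly) (isCyclotomic : IsCyclotomicFamily Φ)
                {k p′ : ℕ} (p-prime : Prime (suc p′)) (m<p : suc k < suc p′) where

  open Cyclotomic Φ isCyclotomic

  private
    m p : ℕ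
    m = suc k
    p = suc p′

  F G Ψₘ : Poly
  F = Φ (m * p)
  G = Φ m
  Ψₘ = Ψ m

  Ψₘ⊛G : (Ψₘ ⊛ G) ≋ x^ m ⊖1
  Ψₘ⊛G = Ψ⊛Φ k

  F⊛G : (F ⊛ G) ≋ expand p′ G
  F⊛G = Φ[np]⊛Φ[n] p-prime m (s≤s z≤n) (λ p∣m → ℕₚ.<⇒≱ m<p (∣⇒≤ p∣m))

  x^m⊖1⊛F : ((x^ m ⊖1) ⊛ F) ≋ (Ψₘ ⊛ expand p′ G)
  x^m⊖1⊛F = begin
    (x^ m ⊖1) ⊛ F  ≈⟨ ⊛-congˡ F Ψₘ⊛G ⟨
    (Ψₘ ⊛ G) ⊛ F   ≈⟨ ⊛-assoc Ψₘ G F ⟩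
    Ψₘ ⊛ (G ⊛ F)   ≈⟨ ⊛-congʳ Ψₘ (≋-trans (⊛-comm G F) F⊛G) ⟩
    Ψₘ ⊛ expand p′ G ∎
    where open ≋-Reasoning

  G∣P-B[xᵖ]⇒G∣P-B : ∀ B → G ∣P expand p′ B → G ∣P B
  G∣P-B[xᵖ]⇒G∣P-B B with pow≡1-mod m p (s≤s z≤n) (s≤s z≤n) (Coprimality.sym (prime⇒coprime p-prime m<p))
  ... | K , t , pᴷ⁺¹≡1+mt =
    ∣P-expand⇒∣P {K = K} (dividesP Ψₘ (≋-trans (⊛-comm G Ψₘ) Ψₘ⊛G)) (dividesP F (≋-trans (⊛-comm G F) F⊛G))
                 pᴷ⁺¹≡1+mt

  module Block (i : ℕ) (i<φ : i < totient m) where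

    N : ℕ
    N = i * p + m
    T W B A : Poly
    T = trunc N F
    W = f-i0 Φ m p i
    B = trunc (suc i) G
    A = expand p′ B

    coeff-W : ∀ j → coeff W j ≡ coeff T (i * p + j)
    coeff-W j with j <? m
    ... | yes j<m = trans (coeff-tabulate-< _ j<m)
                   (trans (coeff-tabulate-< _ (ℕₚ.<-trans j<m m<p)) (sym (coeff-tabulate-< (coeff F) (ℕₚ.+-monoʳ-< (i * p) j<m))))
    ... | no  j≮m = trans (coeff-tabulate-≥ _ (ℕₚ.≮⇒≥ j≮m))
                   (sym (coeff-tabulate-≥ (coeff F) (ℕₚ.+-monoʳ-≤ (i * p) (ℕₚ.≮⇒≥ j≮m))))

    x^m⊖1⊛F-split : ((x^ m ⊖1) ⊛ F) ≋ ((Ψₘ ⊛ A) ⊕ shift (suc i * p) (Ψₘ ⊛ expand p′ (drop (suc i) G)))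
    x^m⊖1⊛F-split = begin
      (x^ m ⊖1) ⊛ F
        ≈⟨ x^m⊖1⊛F ⟩
      Ψₘ ⊛ expand p′ G
        ≈⟨ ⊛-congʳ Ψₘ (expand-cong p′ (trunc-⊕-shift-drop (suc i) G)) ⟨
      Ψₘ ⊛ expand p′ (B ⊕ shift (suc i) R)
        ≈⟨ ⊛-congʳ Ψₘ (≋-trans (expand-⊕ p′ B (shift (suc i) R)) (⊕-congʳ A (expand-shift p′ (suc i) R))) ⟩
      Ψₘ ⊛ (A ⊕ shift (suc i * p) (expand p′ R))
        ≈⟨ ⊛-distribˡ-⊕ Ψₘ A _ ⟩
      (Ψₘ ⊛ A) ⊕ (Ψₘ ⊛ shift (suc i * p) (expand p′ R))
        ≈⟨ ⊕-congʳ (Ψₘ ⊛ A) (⊛-shift (suc i * p) Ψₘ (expand p′ R)) ⟩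
      (Ψₘ ⊛ A) ⊕ shift (suc i * p) (Ψₘ ⊛ expand p′ R) ∎
      where
      open ≋-Reasoning
      R : Poly
      R = drop (suc i) G

    ψ<m : ψ m < m
    ψ<m = ℕₚ.∸-monoʳ-< (ℕₚ.≤-<-trans z≤n i<φ) φ≤m
      where
      φ≤m : totient m ≤ m
      φ≤m = subst (totient m ≤_) (sum-totient-properDivisors k) (ℕₚ.m≤n+m (totient m) _)

    Ψₘ⊛A-Deg≤ : Deg≤ (Ψₘ ⊛ A) (ψ m + i * p)
    Ψₘ⊛A-Deg≤ = ⊛-Deg≤ Ψₘ A (proj₂ (Ψ-Monic k)) (Deg≤-expand p′ B (Deg≤-trunc i G))

    truncation-identity : ((x^ m ⊖1) ⊛ T) ≋ ((Ψₘ ⊛ A) ⊕ shift N W)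
    truncation-identity = mk≋ (split-at N below above)
      where
      below : ∀ n → n < N → coeff ((x^ m ⊖1) ⊛ T) n ≡ coeff ((Ψₘ ⊛ A) ⊕ shift N W) n
      below n n<N = begin
        coeff ((x^ m ⊖1) ⊛ T) n                    ≡⟨ coeff-⊛-trunc (x^ m ⊖1) F n<N ⟩
        coeff ((x^ m ⊖1) ⊛ F) n                    ≡⟨ coeff-≡ x^m⊖1⊛F-split n ⟩
        coeff ((Ψₘ ⊛ A) ⊕ shift (suc i * p) _) n   ≡⟨ coeff-⊕ (Ψₘ ⊛ A) _ n ⟩
        coeff (Ψₘ ⊛ A) n +ℤ coeff (shift (suc i * p) _) n
          ≡⟨ cong (coeff (Ψₘ ⊛ A) n +ℤ_)
               (trans (coeff-shift-< (suc i * p) _ (ℕₚ.<-≤-trans n<N N≤[1+i]p)) (sym (coeff-shift-< N W n<N))) ⟩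
        coeff (Ψₘ ⊛ A) n +ℤ coeff (shift N W) n    ≡⟨ coeff-⊕ (Ψₘ ⊛ A) _ n ⟨
        coeff ((Ψₘ ⊛ A) ⊕ shift N W) n             ∎
        where
        open ≡-Reasoning
        N≤[1+i]p : N ≤ suc i * p
        N≤[1+i]p = subst (N ≤_) (ℕₚ.+-comm (i * p) p) (ℕₚ.+-monoʳ-≤ (i * p) (ℕₚ.<⇒≤ m<p))
      above : ∀ j → coeff ((x^ m ⊖1) ⊛ T) (N + j) ≡ coeff ((Ψₘ ⊛ A) ⊕ shift N W) (N + j)
      above j = begin
        coeff ((x^ m ⊖1) ⊛ T) (N + j)              ≡⟨ cong (coeff ((x^ m ⊖1) ⊛ T)) N+j≡m+[ip+j] ⟩
        coeff ((x^ m ⊖1) ⊛ T) (m + (i * p + j))    ≡⟨ coeff-x^⊖1-⊛ m T (i * p + j) ⟩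
        coeff T (i * p + j) +ℤ - coeff T (m + (i * p + j))
          ≡⟨ cong₂ (λ a b → a +ℤ - b) (sym (coeff-W j))
               (trans (cong (coeff T) (sym N+j≡m+[ip+j])) (coeff-tabulate-≥ (coeff F) (ℕₚ.m≤m+n N j))) ⟩
        coeff W j +ℤ - + 0                        ≡⟨ ℤₚ.+-identityʳ _ ⟩
        coeff W j                                 ≡⟨ ℤₚ.+-identityˡ _ ⟨
        + 0 +ℤ coeff W j
          ≡⟨ cong₂ _+ℤ_ (sym (Ψₘ⊛A-Deg≤ (N + j) (ℕₚ.<-≤-trans high-degree (ℕₚ.m≤m+n N j)))) (sym (coeff-shift-+ N W j)) ⟩
        coeff (Ψₘ ⊛ A) (N + j) +ℤ coeff (shift N W) (N + j) ≡⟨ coeff-⊕ (Ψₘ ⊛ A) _ (N + j) ⟨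
        coeff ((Ψₘ ⊛ A) ⊕ shift N W) (N + j)      ∎
        where
        open ≡-Reasoning
        N+j≡m+[ip+j] : N + j ≡ m + (i * p + j)
        N+j≡m+[ip+j] = trans (cong (_+ j) (ℕₚ.+-comm (i * p) m)) (ℕₚ.+-assoc m (i * p) j)
        high-degree : ψ m + i * p < N
        high-degree = subst (ψ m + i * p <_) (ℕₚ.+-comm m (i * p)) (ℕₚ.+-monoˡ-< (i * p) ψ<m)

    f-i0-≢[] : ¬ (W ≋ [])
    f-i0-≢[] W≋[] with ≋[]⊎IsDeg B
    ... | inj₁ B≋[]         = coeff₀-Φ≢0 k (trans (sym (coeff-tabulate-< (coeff G) {suc i} (s≤s z≤n))) (coeff-≡ B≋[] 0))
    ... | inj₂ (d , B-deg) = ℕₚ.<⇒≱ i<φ (ℕₚ.≤-trans (Monic-∣P-IsDeg⇒≤ (Φ-Monic m (s≤s z≤n)) G∣B B-deg) d≤i)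
      where
      d≤i : d ≤ i
      d≤i = ℕₚ.≮⇒≥ (λ i<d → proj₁ B-deg (Deg≤-trunc i G d i<d))
      x^m⊖1⊛T≋Ψₘ⊛A : ((x^ m ⊖1) ⊛ T) ≋ (Ψₘ ⊛ A)
      x^m⊖1⊛T≋Ψₘ⊛A = ≋-trans truncation-identity
        (≋-trans (⊕-congʳ (Ψₘ ⊛ A) (shift-≋[] N W≋[])) (⊕-identityʳ (Ψₘ ⊛ A)))
      G⊛T≋A : (G ⊛ T) ≋ A
      G⊛T≋A = ⊛-cancelˡ {Q = Ψₘ} (coeff₀-Ψ≢0 k)
        (≋-trans (≋-sym (⊛-assoc Ψₘ G T)) (≋-trans (⊛-congˡ T Ψₘ⊛G) x^m⊖1⊛T≋Ψₘ⊛A))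
      G∣B : G ∣P B
      G∣B = G∣P-B[xᵖ]⇒G∣P-B B (dividesP T G⊛T≋A)

    f-i0-IsTdeg : Σ ℕ (IsTdeg W)
    f-i0-IsTdeg = ≢[]⇒IsTdeg W f-i0-≢[]

    f-i0-IsDeg : Σ ℕ (IsDeg W)
    f-i0-IsDeg with ≋[]⊎IsDeg W
    ... | inj₁ W≋[] = ⊥-elim (f-i0-≢[] W≋[])
    ... | inj₂ W-deg = W-deg

    ψ+tdeg≤deg : ∀ {t d} → IsTdeg W t → IsDeg W d → ψ m + t ≤ d
    ψ+tdeg≤deg = Monic-∣P-shift⇒deg+tdeg≤deg {W = W} (Ψ-Monic k) (dividesP G Ψₘ⊛G) Ψₘ∣xᴺW
      where
      Ψₘ∣xᴺW : Ψₘ ∣P shift N W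
      Ψₘ∣xᴺW = ∣P-⊕⇒∣P (dividesP A ≋-refl)
                 (∣P-respʳ truncation-identity (∣P-⊛ʳ T (dividesP G Ψₘ⊛G)))

  module _ (0<φ : 0 < totient m) where
    open Block 0 0<φ

    f-00≡-G₀Ψₘ : ∀ n → coeff W n ≡ - coeff G 0 *ℤ coeff Ψₘ n
    f-00≡-G₀Ψₘ n = begin
      coeff W n                     ≡⟨ ℤₚ.neg-involutive (coeff W n) ⟨
      - - coeff W n                 ≡⟨ cong -_ (coeff-neg W n) ⟨
      - coeff (neg W) n             ≡⟨ cong -_ (coeff-≡ neg-W≋Ψₘ⊛A n) ⟩
      - coeff (Ψₘ ⊛ A) n            ≡⟨ cong -_ (coeff-≡ Ψₘ⊛A≋G₀Ψₘ n) ⟩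
      - coeff (scale (coeff G 0) Ψₘ) n ≡⟨ cong -_ (coeff-scale (coeff G 0) Ψₘ n) ⟩
      - (coeff G 0 *ℤ coeff Ψₘ n)   ≡⟨ ℤₚ.neg-distribˡ-* (coeff G 0) (coeff Ψₘ n) ⟩
      - coeff G 0 *ℤ coeff Ψₘ n     ∎
      where
      open ≡-Reasoning
      -- For i = 0 the truncation T is W itself, so the identity reads (xᵐ - 1) W = Ψₘ A + xᵐ W.
      neg-W≋Ψₘ⊛A : neg W ≋ (Ψₘ ⊛ A)
      neg-W≋Ψₘ⊛A = ⊕-cancelˡ (shift m W) (≋-trans (≋-sym (x^⊖1-⊛ m W))
        (≋-trans (⊛-congʳ (x^ m ⊖1) (mk≋ {W} {T} coeff-W)) (≋-trans truncation-identity (⊕-comm (Ψₘ ⊛ A) (shift m W)))))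
      Ψₘ⊛A≋G₀Ψₘ : (Ψₘ ⊛ A) ≋ scale (coeff G 0) Ψₘ
      Ψₘ⊛A≋G₀Ψₘ = ≋-trans (⊛-congʳ Ψₘ (∷-cong refl (shift-≋[] p′ ≋-refl)))
        (≋-trans (⊛-∷ʳ Ψₘ (coeff G 0) [])
        (≋-trans (⊕-congʳ (scale (coeff G 0) Ψₘ) (0∷-≋[] (⊛-zeroʳ Ψₘ))) (⊕-identityʳ (scale (coeff G 0) Ψₘ))))

    f-00-IsTdeg : IsTdeg W 0
    f-00-IsTdeg = (λ W₀≡0 → +1≢+0 (trans (sym W₀≡1) W₀≡0)) , λ _ ()
      where
      W₀≡1 : coeff W 0 ≡ + 1
      W₀≡1 = begin
        coeff W 0                     ≡⟨ f-00≡-G₀Ψₘ 0 ⟩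
        - coeff G 0 *ℤ coeff Ψₘ 0     ≡⟨ ℤₚ.neg-distribˡ-* (coeff G 0) (coeff Ψₘ 0) ⟨
        - (coeff G 0 *ℤ coeff Ψₘ 0)   ≡⟨ cong -_ (ℤₚ.*-comm (coeff G 0) (coeff Ψₘ 0)) ⟩
        - (coeff Ψₘ 0 *ℤ coeff G 0)   ≡⟨ cong -_ (coeff₀-Ψ⊛Φ k) ⟩
        + 1                           ∎
        where open ≡-Reasoning

    f-00-IsDeg : IsDeg W (ψ m)
    f-00-IsDeg = scaled-Monic-IsDeg {W} {Ψₘ} f-00≡-G₀Ψₘ -G₀≢0 (Ψ-Monic k)
      where
      -G₀≢0 : - coeff G 0 ≢ + 0
      -G₀≢0 -G₀≡0 = coeff₀-Φ≢0 k (trans (sym (ℤₚ.neg-involutive (coeff G 0))) (cong -_ -G₀≡0))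

    f-00-width : ∀ {t d} → IsTdeg W t → IsDeg W d → ψ m + t ≡ d
    f-00-width {t} {d} W-tdeg W-deg = begin
      ψ m + t  ≡⟨ cong (ℕ._+_ (ψ m)) (IsTdeg-unique {W} W-tdeg f-00-IsTdeg) ⟩
      ψ m + 0  ≡⟨ ℕₚ.+-identityʳ (ψ m) ⟩
      ψ m      ≡⟨ IsDeg-unique {W} f-00-IsDeg W-deg ⟩
      d        ∎
      where open ≡-Reasoning

mainTheorem5 : (Φ : ℕ → Poly) → IsCyclotomicFamily Φ →
    (m p : ℕ) → 1 ≤ m → Prime p → m < p →
    (i : ℕ) → i < totient m →
    Σ ℕ (λ t → Σ ℕ (λ d →
      IsTdeg (f-i0 Φ m p i) t × IsDeg (f-i0 Φ m p i) d ×
      ψ m + t ≤ d × (i ≡ 0 → ψ m + t ≡ d)))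
mainTheorem5 Φ isCyclotomic (suc k) (suc p′) _ p-prime m<p i i<φ =
  let open Theorem5 Φ isCyclotomic p-prime m<p
      open Block i i<φ
      t , W-tdeg = f-i0-IsTdeg
      d , W-deg  = f-i0-IsDeg
  in t , d , W-tdeg , W-deg , ψ+tdeg≤deg W-tdeg W-deg , λ { refl → f-00-width i<φ W-tdeg W-deg }
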